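{- Let $p$ be a prime, $p>3$, and let $x\in D_p$. Then modulo $p$: \begin{align*} w_{\lfloor p/4\rfloor}(2x^2-1)&\equiv \frac{1}{2}\left(\frac{ -2}{p}\right)\left(\left(\frac{1-x}{p}\right)+\left(\frac{1+x}{p}\right)\right),\\ w_{\lfloor 3p/4\rfloor}(2x^2-1)&\equiv \frac{1}{2}\left(\frac{ -2}{p}\right)\left(\left(\frac{1-x}{p}\right)(1+2x)+\left(\frac{1+x}{p}\right)(1-2x)\right). \end{align*}
   Context: The polynomials $w_n(x)$ are defined by $w_0(x)=1$, $w_1(x)=1+2x$, $w_{n+1}(x)=2xw_n(x)-w_{n-1}(x)$. $D_p$ is the set of rationals whose denominator is not divisible by $p$. For $c=a/b\in D_p$ in lowest terms, the Legendre symbol is extended by $\left(\frac{c}{p}\right)=\left(\frac{ab}{p}\right)$, with $\left(\frac{c}{p}\right)=0$ if $p\mid a$. -}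

module Defs where

open import Data.Nat as ℕ using (ℕ; zero; suc)
open import Data.Nat.Divisibility using (_∣_; _∣?_)
open import Data.Integer as ℤ using (ℤ; +_)
open import Data.Rational as ℚ using (ℚ; ↥_; ↧_; ↧ₙ_; 1ℚ; 0ℚ)
open import Data.Fin using (Fin; toℕ)
open import Data.Fin.Properties using (any?)
open import Data.Product using (_×_)
open import Relation.Nullary using (¬_; yes; no)

w : ℕ → ℚ → ℚ
w zero t = 1ℚ
w (suc zero) t = 1ℚ ℚ.+ (+ 2 ℚ./ 1) ℚ.* t
w (suc (suc n)) t = (+ 2 ℚ./ 1) ℚ.* t ℚ.* w (suc n) t ℚ.- w n t

InD : ℕ → ℚ → Set
InD p c = ¬ (p ∣ (↧ₙ c))

legendreℤ : (p : ℕ) → ℤ → ℤ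
legendreℤ p a with p ∣? ℤ.∣ a ∣
... | yes _ = + 0
... | no _ with any? {n = p} (λ (y : Fin p) → p ∣? ℤ.∣ (+ toℕ y) ℤ.* (+ toℕ y) ℤ.- a ∣)
...   | yes _ = + 1
...   | no _ = ℤ.- (+ 1)

legendre : ℚ → ℕ → ℚ
legendre c p = legendreℤ p ((↥ c) ℤ.* (↧ c)) ℚ./ 1

-- Congruence modulo p between rationals: a - b ∈ p D_p,
-- i.e. the reduced numerator of a - b is divisible by p and its denominator is not.
infix 4 _≡_[mod_]
_≡_[mod_] : ℚ → ℚ → ℕ → Set
a ≡ b [mod p ] = (p ∣ ℤ.∣ ↥ (a ℚ.- b) ∣) × ¬ (p ∣ ↧ₙ (a ℚ.- b))

-- Write x ≡ z mod p, t = 2z² - 1 and p = 2h + 1, and adjoin to ℤ/p square roots α, β of 1 + z and z - 1.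
-- The element ξ = z + αβ has trace 2z and norm 1, so the αβ-coefficient of ξ^(2n+1) satisfies the
-- recurrence of w_n(t); and e = α + β has e² = 2ξ. For m ∈ {1, 3} the index N = 2⌊mp/4⌋ + 1 satisfies
-- 2N = mp ± 1, so ξ^N is read off from e^(mp ± 1) = e^(±1) (e^m)^p. The Frobenius map fixes ℤ/p and sends
-- α, β to (1 + z)^h α and (z - 1)^h β, and by Euler's criterion these powers are Legendre symbols.
module Submission where

open import Level using (0ℓ)
open import Function using (_∘_)
open import Data.Nat as ℕ using (ℕ; zero; suc; _<_; s≤s; z≤n)
import Data.Nat.Properties as ℕP
import Data.Nat.DivMod as ℕ÷
open import Data.Nat.Divisibility as ℕ∣ using (divides; _∣?_)
open import Data.Nat.Primality using (Prime; euclidsLemma; prime⇒nonZero; prime⇒nonTrivial; prime⇒irreducible)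
import Data.Nat.Coprimality as Coprime
open import Data.Nat.Combinatorics using (_C_; nCn≡1; nC1≡n; nCk+nC[k+1]≡[n+1]C[k+1])
import Data.Nat.Tactic.RingSolver as ℕ-Solver
open import Data.Integer as ℤ using (ℤ; +_; 0ℤ; 1ℤ)
import Data.Integer.Properties as ℤP
import Data.Integer.DivMod as ℤ÷
import Data.Integer.Divisibility.Signed as ℤ∣
open import Data.Integer.Tactic.RingSolver using (solve-∀)
open import Data.Rational as ℚ using (ℚ; mkℚ; ↥_; ↧_; ↧ₙ_; 1ℚ; ½; toℚᵘ)
open import Data.Rational.Unnormalised as ℚᵘ using (ℚᵘ; mkℚᵘ; *≡*)
import Data.Rational.Properties as ℚP
open import Data.Fin as Fin using (Fin; toℕ; inject₁; fromℕ; fromℕ<)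
open import Data.Fin.Properties using (any?; toℕ-fromℕ; toℕ-fromℕ<; toℕ-inject₁; toℕ<n)
open import Data.Bool using (Bool; true; false; if_then_else_)
open import Data.Product using (Σ; _,_; proj₁; proj₂)
open import Data.Sum using (_⊎_; inj₁; inj₂; [_,_]′)
open import Data.Empty using (⊥-elim)
open import Relation.Nullary using (¬_; yes; no)
open import Relation.Binary.PropositionalEquality as ≡ using (_≡_; _≢_; cong; cong₂)
open import Relation.Binary.Structures using (IsEquivalence)
open import Relation.Binary.Bundles using (Setoid)
open import Algebra.Bundles using (CommutativeSemiring)
open import Algebra.Structures.Biased using (IsCommutativeSemiringˡ)
open import Defs using (w; InD; legendreℤ; legendre; _≡_[mod_])

module Congruence (p : ℕ) where

  infix 4 _≈_
  -- A record rather than the divisibility itself, so that a and b can be inferred from a proof of a ≈ b.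
  record _≈_ (a b : ℤ) : Set where
    constructor mod
    field divisible : + p ℤ∣.∣ a ℤ.- b
  open _≈_

  private
    resp : ∀ {x y} → x ≡ y → + p ℤ∣.∣ x → + p ℤ∣.∣ y
    resp = ≡.subst (+ p ℤ∣.∣_)

    sub-swap : ∀ a b → ℤ.- (a ℤ.- b) ≡ b ℤ.- a
    sub-swap = solve-∀
    sub-chain : ∀ a b c → (a ℤ.- b) ℤ.+ (b ℤ.- c) ≡ a ℤ.- c
    sub-chain = solve-∀
    sub-+ : ∀ a b c d → (a ℤ.- b) ℤ.+ (c ℤ.- d) ≡ (a ℤ.+ c) ℤ.- (b ℤ.+ d)
    sub-+ = solve-∀
    sub-* : ∀ a b c d → (a ℤ.- b) ℤ.* c ℤ.+ b ℤ.* (c ℤ.- d) ≡ a ℤ.* c ℤ.- b ℤ.* d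
    sub-* = solve-∀
    sub-neg : ∀ a b → ℤ.- (a ℤ.- b) ≡ ℤ.- a ℤ.- ℤ.- b
    sub-neg = solve-∀
    sub-0 : ∀ a → a ≡ a ℤ.- 0ℤ
    sub-0 = solve-∀

  ≈-refl : ∀ {a} → a ≈ a
  ≈-refl {a} = mod (resp (≡.sym (ℤP.+-inverseʳ a)) (ℤ∣.divides 0ℤ ≡.refl))

  ≈-sym : ∀ {a b} → a ≈ b → b ≈ a
  ≈-sym {a} {b} (mod a≈b) = mod (resp (sub-swap a b) (ℤ∣.∣m⇒∣-m a≈b))

  ≈-trans : ∀ {a b c} → a ≈ b → b ≈ c → a ≈ c
  ≈-trans {a} {b} {c} (mod a≈b) (mod b≈c) = mod (resp (sub-chain a b c) (ℤ∣.∣m∣n⇒∣m+n a≈b b≈c))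

  ≡⇒≈ : ∀ {a b} → a ≡ b → a ≈ b
  ≡⇒≈ ≡.refl = ≈-refl

  +-cong : ∀ {a b c d} → a ≈ b → c ≈ d → a ℤ.+ c ≈ b ℤ.+ d
  +-cong {a} {b} {c} {d} (mod a≈b) (mod c≈d) = mod (resp (sub-+ a b c d) (ℤ∣.∣m∣n⇒∣m+n a≈b c≈d))

  *-cong : ∀ {a b c d} → a ≈ b → c ≈ d → a ℤ.* c ≈ b ℤ.* d
  *-cong {a} {b} {c} {d} (mod a≈b) (mod c≈d) =
    mod (resp (sub-* a b c d) (ℤ∣.∣m∣n⇒∣m+n (ℤ∣.∣m⇒∣m*n c a≈b) (ℤ∣.∣n⇒∣m*n b c≈d)))

  +-congˡ : ∀ {a b c} → b ≈ c → a ℤ.+ b ≈ a ℤ.+ c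
  +-congˡ {a} = +-cong (≈-refl {a})

  +-congʳ : ∀ {a b c} → b ≈ c → b ℤ.+ a ≈ c ℤ.+ a
  +-congʳ {a} b≈c = +-cong b≈c (≈-refl {a})

  *-congˡ : ∀ {a b c} → b ≈ c → a ℤ.* b ≈ a ℤ.* c
  *-congˡ {a} = *-cong (≈-refl {a})

  *-congʳ : ∀ {a b c} → b ≈ c → b ℤ.* a ≈ c ℤ.* a
  *-congʳ {a} b≈c = *-cong b≈c (≈-refl {a})

  -‿cong : ∀ {a b} → a ≈ b → ℤ.- a ≈ ℤ.- b
  -‿cong {a} {b} (mod a≈b) = mod (resp (sub-neg a b) (ℤ∣.∣m⇒∣-m a≈b))

  multiple≈0 : ∀ k → k ℤ.* + p ≈ 0ℤ
  multiple≈0 k = mod (resp (sub-0 (k ℤ.* + p)) (ℤ∣.divides k ≡.refl))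

  ≈⇒∣ : ∀ {a b} → a ≈ b → p ℕ∣.∣ ℤ.∣ a ℤ.- b ∣
  ≈⇒∣ (mod a≈b) = ℤ∣.∣⇒∣ᵤ a≈b

  ∣⇒≈ : ∀ {a b} → p ℕ∣.∣ ℤ.∣ a ℤ.- b ∣ → a ≈ b
  ∣⇒≈ p∣a-b = mod (ℤ∣.∣ᵤ⇒∣ p∣a-b)

  ≈0⇒∣ : ∀ {a} → a ≈ 0ℤ → p ℕ∣.∣ ℤ.∣ a ∣
  ≈0⇒∣ {a} a≈0 = ≡.subst (λ x → p ℕ∣.∣ ℤ.∣ x ∣) (≡.sym (sub-0 a)) (≈⇒∣ a≈0)

  ∣⇒≈0 : ∀ {a} → p ℕ∣.∣ ℤ.∣ a ∣ → a ≈ 0ℤ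
  ∣⇒≈0 {a} p∣a = ∣⇒≈ (≡.subst (λ x → p ℕ∣.∣ ℤ.∣ x ∣) (sub-0 a) p∣a)

  x-y≈0⇒x≈y : ∀ {a b} → a ℤ.- b ≈ 0ℤ → a ≈ b
  x-y≈0⇒x≈y {a} {b} (mod p∣) = mod (resp (≡.sym (sub-0 (a ℤ.- b))) p∣)

  x≈y⇒x-y≈0 : ∀ {a b} → a ≈ b → a ℤ.- b ≈ 0ℤ
  x≈y⇒x-y≈0 {a} {b} (mod p∣) = mod (resp (sub-0 (a ℤ.- b)) p∣)

  x+y≈z⇒x≈z-y : ∀ {x y z} → x ℤ.+ y ≈ z → x ≈ z ℤ.- y
  x+y≈z⇒x≈z-y {x} {y} {z} x+y≈z = ≈-trans (≡⇒≈ (cancel x y)) (+-congʳ {ℤ.- y} x+y≈z)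
    where
    cancel : ∀ x y → x ≡ x ℤ.+ y ℤ.- y
    cancel = solve-∀

  ≈-isEquivalence : IsEquivalence _≈_
  ≈-isEquivalence = record { refl = ≈-refl ; sym = ≈-sym ; trans = ≈-trans }

  ≈-setoid : Setoid 0ℓ 0ℓ
  ≈-setoid = record { isEquivalence = ≈-isEquivalence }

  commutativeSemiring : CommutativeSemiring 0ℓ 0ℓ
  commutativeSemiring = record
    { _≈_ = _≈_ ; _+_ = ℤ._+_ ; _*_ = ℤ._*_ ; 0# = 0ℤ ; 1# = 1ℤ
    ; isCommutativeSemiring = IsCommutativeSemiringˡ.isCommutativeSemiring record
      { +-isCommutativeMonoid = record
        { isMonoid = record
          { isSemigroup = record
            { isMagma = record { isEquivalence = ≈-isEquivalence ; ∙-cong = +-cong }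
            ; assoc = λ x y z → ≡⇒≈ (ℤP.+-assoc x y z) }
          ; identity = (λ x → ≡⇒≈ (ℤP.+-identityˡ x)) , (λ x → ≡⇒≈ (ℤP.+-identityʳ x)) }
        ; comm = λ x y → ≡⇒≈ (ℤP.+-comm x y) }
      ; *-isCommutativeMonoid = record
        { isMonoid = record
          { isSemigroup = record
            { isMagma = record { isEquivalence = ≈-isEquivalence ; ∙-cong = *-cong }
            ; assoc = λ x y z → ≡⇒≈ (ℤP.*-assoc x y z) }
          ; identity = (λ x → ≡⇒≈ (ℤP.*-identityˡ x)) , (λ x → ≡⇒≈ (ℤP.*-identityʳ x)) }
        ; comm = λ x y → ≡⇒≈ (ℤP.*-comm x y) }
      ; distribʳ = λ x y z → ≡⇒≈ (ℤP.*-distribʳ-+ x y z)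
      ; zeroˡ = λ x → ≡⇒≈ (ℤP.*-zeroˡ x)
      }
    }

  open CommutativeSemiring commutativeSemiring using (semiring)
  open import Algebra.Properties.Semiring.Exp semiring public using (_^_; ^-congˡ; ^-congʳ; ^-homo-*)

  [-1]^[k+k]≈1 : ∀ k → (ℤ.- 1ℤ) ^ (k ℕ.+ k) ≈ 1ℤ
  [-1]^[k+k]≈1 zero    = ≈-refl
  [-1]^[k+k]≈1 (suc k) = ≈-trans (^-congʳ (ℤ.- 1ℤ) (≡.cong suc (ℕP.+-suc k k)))
                           (≈-trans (≡⇒≈ (neg-neg ((ℤ.- 1ℤ) ^ (k ℕ.+ k)))) ([-1]^[k+k]≈1 k))
    where
    neg-neg : ∀ x → ℤ.- 1ℤ ℤ.* (ℤ.- 1ℤ ℤ.* x) ≡ x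
    neg-neg = solve-∀

[1+k]*[1+n]C[1+k]≡[1+n]*nCk : ∀ n k → suc k ℕ.* (suc n C suc k) ≡ suc n ℕ.* (n C k)
[1+k]*[1+n]C[1+k]≡[1+n]*nCk zero    zero    = ≡.refl
[1+k]*[1+n]C[1+k]≡[1+n]*nCk zero    (suc k) = ℕP.*-zeroʳ (suc (suc k))
[1+k]*[1+n]C[1+k]≡[1+n]*nCk (suc m) zero    = ≡.trans (ℕP.*-identityˡ _) (≡.trans (nC1≡n (suc (suc m))) (≡.sym (ℕP.*-identityʳ _)))
[1+k]*[1+n]C[1+k]≡[1+n]*nCk (suc m) (suc k) = begin
  suc (suc k) ℕ.* (suc n C suc (suc k))     ≡⟨ cong (suc (suc k) ℕ.*_) (nCk+nC[k+1]≡[n+1]C[k+1] n (suc k)) ⟨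
  suc (suc k) ℕ.* (A ℕ.+ B)                 ≡⟨ split k A B ⟩
  suc k ℕ.* A ℕ.+ A ℕ.+ suc (suc k) ℕ.* B  ≡⟨ cong₂ (λ u v → u ℕ.+ A ℕ.+ v)
                                                 ([1+k]*[1+n]C[1+k]≡[1+n]*nCk m k) ([1+k]*[1+n]C[1+k]≡[1+n]*nCk m (suc k)) ⟩
  n ℕ.* (m C k) ℕ.+ A ℕ.+ n ℕ.* (m C suc k) ≡⟨ merge n (m C k) (m C suc k) A ⟩
  n ℕ.* (m C k ℕ.+ m C suc k) ℕ.+ A        ≡⟨ cong (λ u → n ℕ.* u ℕ.+ A) (nCk+nC[k+1]≡[n+1]C[k+1] m k) ⟩
  n ℕ.* A ℕ.+ A                             ≡⟨ ℕP.+-comm (n ℕ.* A) A ⟩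
  suc n ℕ.* A                               ∎
  where
  open ≡.≡-Reasoning
  n A B : ℕ
  n = suc m
  A = n C suc k
  B = n C suc (suc k)
  split : ∀ k A B → suc (suc k) ℕ.* (A ℕ.+ B) ≡ suc k ℕ.* A ℕ.+ A ℕ.+ suc (suc k) ℕ.* B
  split = ℕ-Solver.solve-∀
  merge : ∀ n X Y A → n ℕ.* X ℕ.+ A ℕ.+ n ℕ.* Y ≡ n ℕ.* (X ℕ.+ Y) ℕ.+ A
  merge = ℕ-Solver.solve-∀

prime∣pCk : ∀ {p k} → Prime p → 0 ℕ.< k → k ℕ.< p → p ℕ∣.∣ p C k
prime∣pCk {suc n} {suc k} p-prime _ k<p
  with euclidsLemma (suc k) (suc n C suc k) p-prime (divides (n C k) (≡.trans ([1+k]*[1+n]C[1+k]≡[1+n]*nCk n k) (ℕP.*-comm (suc n) (n C k))))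
... | inj₁ p∣1+k = ⊥-elim (ℕP.<⇒≱ k<p (ℕ∣.∣⇒≤ p∣1+k))
... | inj₂ p∣pCk = p∣pCk

module Frobenius {c ℓ} (S : CommutativeSemiring c ℓ) {p : ℕ} (p-prime : Prime p) where
  open CommutativeSemiring S
  open import Algebra.Properties.CommutativeSemiring.Binomial S using (binomialTerm; theorem)
  open import Algebra.Properties.Semiring.Mult semiring using (_×_; ×-assocˡ; ×-congʳ; ×-homo-1)
  open import Algebra.Properties.Semiring.Exp semiring using (_^_)
  open import Algebra.Properties.Monoid.Sum +-monoid using (sum)
  open import Relation.Binary.Reasoning.Setoid setoid

  module _ (char : ∀ x → p × x ≈ 0#) where

    private
      ×-zero : ∀ q → q × 0# ≈ 0#
      ×-zero zero    = refl
      ×-zero (suc q) = trans (+-identityˡ _) (×-zero q)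

      multiple×≈0 : ∀ m x → p ℕ∣.∣ m → m × x ≈ 0#
      multiple×≈0 m x (divides q ≡.refl) = begin
        (q ℕ.* p) × x ≈⟨ ×-assocˡ x q p ⟨
        q × (p × x)   ≈⟨ ×-congʳ q (char x) ⟩
        q × 0#        ≈⟨ ×-zero q ⟩
        0#            ∎

      sum-last : ∀ n (t : Fin (suc n) → Carrier) → (∀ i → t (inject₁ i) ≈ 0#) → sum t ≈ t (fromℕ n)
      sum-last zero    t _ = +-identityʳ (t Fin.zero)
      sum-last (suc n) t t≈0 = begin
        t Fin.zero + sum (λ i → t (Fin.suc i)) ≈⟨ +-cong (t≈0 Fin.zero) (sum-last n (λ i → t (Fin.suc i)) (λ i → t≈0 (Fin.suc i))) ⟩
        0# + t (fromℕ (suc n))                ≈⟨ +-identityˡ _ ⟩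
        t (fromℕ (suc n))                     ∎

    frobenius : ∀ x y → (x + y) ^ p ≈ x ^ p + y ^ p
    frobenius x y = expand p ≡.refl
      where
      term : ∀ n → Fin (suc n) → Carrier
      term = binomialTerm x y
      expand : ∀ n → n ≡ p → (x + y) ^ n ≈ x ^ n + y ^ n
      expand zero    ≡.refl = ⊥-elim (ℕ.NonZero.nonZero (prime⇒nonZero p-prime))
      expand (suc n) ≡.refl = begin
        (x + y) ^ suc n                                         ≈⟨ theorem (suc n) x y ⟩
        term (suc n) Fin.zero + sum (λ i → term (suc n) (Fin.suc i)) ≈⟨ +-cong refl (sum-last n (λ i → term (suc n) (Fin.suc i)) inner≈0) ⟩
        term (suc n) Fin.zero + term (suc n) (fromℕ (suc n))  ≈⟨ +-cong (trans (×-homo-1 _) (*-identityˡ _)) last ⟩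
        y ^ suc n + x ^ suc n                                   ≈⟨ +-comm _ _ ⟩
        x ^ suc n + y ^ suc n                                   ∎
        where
        inner≈0 : ∀ (i : Fin n) → term (suc n) (Fin.suc (inject₁ i)) ≈ 0#
        inner≈0 i = multiple×≈0 _ _
          (prime∣pCk p-prime (ℕ.s≤s ℕ.z≤n) (ℕ.s≤s (≡.subst (ℕ._< n) (≡.sym (toℕ-inject₁ i)) (toℕ<n i))))
        last : term (suc n) (fromℕ (suc n)) ≈ x ^ suc n
        last = top-term (suc n) _ (cong suc (toℕ-fromℕ n))
          where
          top-term : ∀ k j → j ≡ k → (k C j) × (x ^ j * y ^ (k ℕ.∸ j)) ≈ x ^ k
          top-term k .k ≡.refl rewrite nCn≡1 k | ℕP.n∸n≡0 k = trans (×-homo-1 _) (*-identityʳ _)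

-- S[√d]: pairs (x₀ , x₁) standing for x₀ + x₁ √d.
module Adjoin {c ℓ} (S : CommutativeSemiring c ℓ) (d : CommutativeSemiring.Carrier S) where
  open import Data.Product using (_×_)
  open CommutativeSemiring S
  open import Algebra.Solver.Ring.NaturalCoefficients.Default S
  open import Algebra.Properties.Semiring.Exp semiring using (_^_)
  open import Algebra.Properties.Monoid.Mult +-monoid using () renaming (_×_ to _×₀_)

  infix  4 _≋_
  infixl 6 _⊕_
  infixl 7 _⊗_

  record _≋_ (x y : Carrier × Carrier) : Set ℓ where
    constructor _,_
    field
      re : proj₁ x ≈ proj₁ y
      im : proj₂ x ≈ proj₂ y

  -- Opaque, so that normalising expressions over S[√d] does not unfold them into S.
  opaque
    _⊕_ _⊗_ : Carrier × Carrier → Carrier × Carrier → Carrier × Carrier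
    (x₀ , x₁) ⊕ (y₀ , y₁) = x₀ + y₀ , x₁ + y₁
    (x₀ , x₁) ⊗ (y₀ , y₁) = x₀ * y₀ + d * (x₁ * y₁) , x₀ * y₁ + x₁ * y₀

  ι : Carrier → Carrier × Carrier
  ι x = x , 0#

  √d : Carrier × Carrier
  √d = 0# , 1#

  private
    ≋-trans : ∀ {x y z} → x ≋ y → y ≋ z → x ≋ z
    ≋-trans (p₀ , p₁) (q₀ , q₁) = trans p₀ q₀ , trans p₁ q₁

    ≋-isEquivalence : IsEquivalence _≋_
    ≋-isEquivalence = record
      { refl  = refl , refl
      ; sym   = λ (p₀ , p₁) → sym p₀ , sym p₁
      ; trans = ≋-trans
      }

  opaque
    unfolding _⊕_ _⊗_

    ⊕-cong : ∀ {x x′ y y′} → x ≋ x′ → y ≋ y′ → x ⊕ y ≋ x′ ⊕ y′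
    ⊕-cong (p₀ , p₁) (q₀ , q₁) = +-cong p₀ q₀ , +-cong p₁ q₁

    ⊕-assoc : ∀ x y z → (x ⊕ y) ⊕ z ≋ x ⊕ (y ⊕ z)
    ⊕-assoc x y z = +-assoc _ _ _ , +-assoc _ _ _

    ⊕-comm : ∀ x y → x ⊕ y ≋ y ⊕ x
    ⊕-comm x y = +-comm _ _ , +-comm _ _

    ⊕-identityˡ : ∀ x → ι 0# ⊕ x ≋ x
    ⊕-identityˡ x = +-identityˡ _ , +-identityˡ _

    ⊕-identityʳ : ∀ x → x ⊕ ι 0# ≋ x
    ⊕-identityʳ x = +-identityʳ _ , +-identityʳ _

    ⊗-cong : ∀ {x x′ y y′} → x ≋ x′ → y ≋ y′ → x ⊗ y ≋ x′ ⊗ y′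
    ⊗-cong (p₀ , p₁) (q₀ , q₁) = +-cong (*-cong p₀ q₀) (*-cong refl (*-cong p₁ q₁)) , +-cong (*-cong p₀ q₁) (*-cong p₁ q₀)

    ⊗-assoc : ∀ x y z → (x ⊗ y) ⊗ z ≋ x ⊗ (y ⊗ z)
    ⊗-assoc (x₀ , x₁) (y₀ , y₁) (z₀ , z₁) =
      solve 7 (λ d x₀ x₁ y₀ y₁ z₀ z₁ →
        (x₀ :* y₀ :+ d :* (x₁ :* y₁)) :* z₀ :+ d :* ((x₀ :* y₁ :+ x₁ :* y₀) :* z₁)
        := x₀ :* (y₀ :* z₀ :+ d :* (y₁ :* z₁)) :+ d :* (x₁ :* (y₀ :* z₁ :+ y₁ :* z₀))) refl d x₀ x₁ y₀ y₁ z₀ z₁ ,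
      solve 7 (λ d x₀ x₁ y₀ y₁ z₀ z₁ →
        (x₀ :* y₀ :+ d :* (x₁ :* y₁)) :* z₁ :+ (x₀ :* y₁ :+ x₁ :* y₀) :* z₀
        := x₀ :* (y₀ :* z₁ :+ y₁ :* z₀) :+ x₁ :* (y₀ :* z₀ :+ d :* (y₁ :* z₁))) refl d x₀ x₁ y₀ y₁ z₀ z₁

    ⊗-comm : ∀ x y → x ⊗ y ≋ y ⊗ x
    ⊗-comm (x₀ , x₁) (y₀ , y₁) =
      +-cong (*-comm x₀ y₀) (*-cong refl (*-comm x₁ y₁)) ,
      trans (+-comm _ _) (+-cong (*-comm x₁ y₀) (*-comm x₀ y₁))

    ⊗-identityˡ : ∀ x → ι 1# ⊗ x ≋ x
    ⊗-identityˡ (x₀ , x₁) =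
      solve 3 (λ d x₀ x₁ → con 1 :* x₀ :+ d :* (con 0 :* x₁) := x₀) refl d x₀ x₁ ,
      solve 2 (λ x₀ x₁ → con 1 :* x₁ :+ con 0 :* x₀ := x₁) refl x₀ x₁

    ⊗-distribʳ : ∀ x y z → (y ⊕ z) ⊗ x ≋ y ⊗ x ⊕ z ⊗ x
    ⊗-distribʳ (x₀ , x₁) (y₀ , y₁) (z₀ , z₁) =
      solve 7 (λ d x₀ x₁ y₀ y₁ z₀ z₁ →
        (y₀ :+ z₀) :* x₀ :+ d :* ((y₁ :+ z₁) :* x₁)
        := (y₀ :* x₀ :+ d :* (y₁ :* x₁)) :+ (z₀ :* x₀ :+ d :* (z₁ :* x₁))) refl d x₀ x₁ y₀ y₁ z₀ z₁ ,
      solve 6 (λ x₀ x₁ y₀ y₁ z₀ z₁ →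
        (y₀ :+ z₀) :* x₁ :+ (y₁ :+ z₁) :* x₀
        := (y₀ :* x₁ :+ y₁ :* x₀) :+ (z₀ :* x₁ :+ z₁ :* x₀)) refl x₀ x₁ y₀ y₁ z₀ z₁

    ⊗-zeroˡ : ∀ x → ι 0# ⊗ x ≋ ι 0#
    ⊗-zeroˡ (x₀ , x₁) =
      solve 3 (λ d x₀ x₁ → con 0 :* x₀ :+ d :* (con 0 :* x₁) := con 0) refl d x₀ x₁ ,
      solve 2 (λ x₀ x₁ → con 0 :* x₁ :+ con 0 :* x₀ := con 0) refl x₀ x₁

    ι-+ : ∀ x y → ι (x + y) ≋ ι x ⊕ ι y
    ι-+ x y = refl , sym (+-identityˡ 0#)

    ι-* : ∀ x y → ι (x * y) ≋ ι x ⊗ ι y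
    ι-* x y = solve 3 (λ d x y → x :* y := x :* y :+ d :* (con 0 :* con 0)) refl d x y ,
              solve 2 (λ x y → con 0 := x :* con 0 :+ con 0 :* y) refl x y

    √d²≋ιd : √d ⊗ √d ≋ ι d
    √d²≋ιd = solve 1 (λ d → con 0 :* con 0 :+ d :* (con 1 :* con 1) := d) refl d ,
             solve 0 (con 0 :* con 1 :+ con 1 :* con 0 := con 0) refl

    ι⊗√d : ∀ x → ι x ⊗ √d ≋ (0# , x)
    ι⊗√d x = solve 2 (λ d x → x :* con 0 :+ d :* (con 0 :* con 1) := con 0) refl d x ,
             solve 1 (λ x → x :* con 1 :+ con 0 :* con 0 := x) refl x

    ⊕-coordinatewise : ∀ x y → x ⊕ y ≋ (proj₁ x + proj₁ y , proj₂ x + proj₂ y)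
    ⊕-coordinatewise x y = refl , refl

    im-ι⊗ : ∀ r x → proj₂ (ι r ⊗ x) ≈ r * proj₂ x
    im-ι⊗ r (x₀ , x₁) = solve 3 (λ r x₀ x₁ → r :* x₁ :+ con 0 :* x₀ := r :* x₁) refl r x₀ x₁

  commutativeSemiring : CommutativeSemiring c ℓ
  commutativeSemiring = record
    { Carrier = Carrier × Carrier ; _≈_ = _≋_ ; _+_ = _⊕_ ; _*_ = _⊗_ ; 0# = ι 0# ; 1# = ι 1#
    ; isCommutativeSemiring = IsCommutativeSemiringˡ.isCommutativeSemiring record
      { +-isCommutativeMonoid = record
        { isMonoid = record
          { isSemigroup = record { isMagma = record { isEquivalence = ≋-isEquivalence ; ∙-cong = ⊕-cong } ; assoc = ⊕-assoc }
          ; identity = ⊕-identityˡ , ⊕-identityʳ }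
        ; comm = ⊕-comm }
      ; *-isCommutativeMonoid = record
        { isMonoid = record
          { isSemigroup = record { isMagma = record { isEquivalence = ≋-isEquivalence ; ∙-cong = ⊗-cong } ; assoc = ⊗-assoc }
          ; identity = ⊗-identityˡ , λ x → ≋-trans (⊗-comm x (ι 1#)) (⊗-identityˡ x) }
        ; comm = ⊗-comm }
      ; distribʳ = ⊗-distribʳ
      ; zeroˡ = ⊗-zeroˡ
      }
    }

  open import Algebra.Properties.Semiring.Exp (CommutativeSemiring.semiring commutativeSemiring)
    using () renaming (_^_ to _^′_)
  open import Algebra.Properties.Monoid.Mult (CommutativeSemiring.+-monoid commutativeSemiring)
    using () renaming (_×_ to _×′_)

  ι-cong : ∀ {x y} → x ≈ y → ι x ≋ ι y
  ι-cong x≈y = x≈y , refl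

  ι-^ : ∀ x n → ι (x ^ n) ≋ ι x ^′ n
  ι-^ x zero    = refl , refl
  ι-^ x (suc n) = ≋-trans (ι-* x (x ^ n)) (⊗-cong (refl , refl) (ι-^ x n))

  ×′-coordinatewise : ∀ n x → n ×′ x ≋ (n ×₀ proj₁ x , n ×₀ proj₂ x)
  ×′-coordinatewise zero    x = refl , refl
  ×′-coordinatewise (suc n) x = ≋-trans (⊕-cong (refl , refl) (×′-coordinatewise n x)) (⊕-coordinatewise x _)

  characteristic : ∀ {q} → (∀ x → q ×₀ x ≈ 0#) → ∀ x → q ×′ x ≋ ι 0#
  characteristic {q} char x = ≋-trans (×′-coordinatewise q x) (char (proj₁ x) , char (proj₂ x))

module PrimeField (p : ℕ) (p-prime : Prime p) where
  open Congruence p public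
  open CommutativeSemiring commutativeSemiring using (semiring)
  open import Algebra.Properties.Semiring.Mult semiring using (_×_)
  open import Relation.Binary.Reasoning.Setoid ≈-setoid

  instance
    p≢0 : ℕ.NonZero p
    p≢0 = prime⇒nonZero p-prime

  1<p : 1 ℕ.< p
  1<p = ℕ.nonTrivial⇒n>1 p {{prime⇒nonTrivial p-prime}}

  ≈0-product : ∀ {a b} → a ℤ.* b ≈ 0ℤ → a ≈ 0ℤ ⊎ b ≈ 0ℤ
  ≈0-product {a} {b} ab≈0 with euclidsLemma ℤ.∣ a ∣ ℤ.∣ b ∣ p-prime (≡.subst (p ℕ∣.∣_) (ℤP.abs-* a b) (≈0⇒∣ ab≈0))
  ... | inj₁ p∣a = inj₁ (∣⇒≈0 p∣a)
  ... | inj₂ p∣b = inj₂ (∣⇒≈0 p∣b)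

  *-cancelˡ : ∀ {a b c} → ¬ c ≈ 0ℤ → c ℤ.* a ≈ c ℤ.* b → a ≈ b
  *-cancelˡ {a} {b} {c} c≉0 ca≈cb with ≈0-product (≈-trans (≡⇒≈ (factor c a b)) (x≈y⇒x-y≈0 ca≈cb))
    where
    factor : ∀ c a b → c ℤ.* (a ℤ.- b) ≡ c ℤ.* a ℤ.- c ℤ.* b
    factor = solve-∀
  ... | inj₁ c≈0   = ⊥-elim (c≉0 c≈0)
  ... | inj₂ a-b≈0 = x-y≈0⇒x≈y a-b≈0

  residue : ℤ → ℕ
  residue a = a ℤ.%ℕ p

  residue<p : ∀ a → residue a ℕ.< p
  residue<p a = ℤ÷.n%ℕd<d a p

  residue≈ : ∀ a → + residue a ≈ a
  residue≈ a = begin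
    + residue a                          ≡⟨ ℤP.+-identityʳ (+ residue a) ⟨
    + residue a ℤ.+ 0ℤ                   ≈⟨ +-congˡ {+ residue a} (multiple≈0 (a ℤ./ℕ p)) ⟨
    + residue a ℤ.+ (a ℤ./ℕ p) ℤ.* + p   ≡⟨ ℤ÷.a≡a%ℕn+[a/ℕn]*n a p ⟨
    a                                    ∎

  residue-unique : ∀ {m n} → + m ≈ + n → m ℕ.< p → n ℕ.< p → m ≡ n
  residue-unique {m} {n} m≈n m<p n<p = ℤP.+-injective (ℤP.i-j≡0⇒i≡j (+ m) (+ n) (ℤP.∣i∣≡0⇒i≡0 (small (≈⇒∣ m≈n) bound)))
    where
    small : ∀ {k} → p ℕ∣.∣ k → k ℕ.< p → k ≡ 0
    small {zero}  _   _   = ≡.refl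
    small {suc k} p∣k k<p = ⊥-elim (ℕP.<⇒≱ k<p (ℕ∣.∣⇒≤ p∣k))
    bound : ℤ.∣ + m ℤ.- + n ∣ ℕ.< p
    bound = ≡.subst (ℕ._< p) (≡.cong ℤ.∣_∣ (≡.sym (ℤP.[+m]-[+n]≡m⊖n m n)))
                    (ℕP.≤-<-trans (ℤP.∣m⊝n∣≤m⊔n m n) (ℕP.⊔-lub m<p n<p))

  ×≈* : ∀ n a → n × a ≈ + n ℤ.* a
  ×≈* zero    a = ≡⇒≈ (≡.sym (ℤP.*-zeroˡ a))
  ×≈* (suc n) a = ≈-trans (+-congˡ {a} (×≈* n a)) (≡⇒≈ (≡.sym (ℤP.suc-* (+ n) a)))

  characteristic : ∀ a → p × a ≈ 0ℤ
  characteristic a = ≈-trans (×≈* p a) (≈-trans (≡⇒≈ (ℤP.*-comm (+ p) a)) (multiple≈0 a))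

  open Frobenius commutativeSemiring p-prime using (frobenius)

  1^n≈1 : ∀ n → 1ℤ ^ n ≈ 1ℤ
  1^n≈1 zero    = ≈-refl
  1^n≈1 (suc n) = ≈-trans (≡⇒≈ (ℤP.*-identityˡ _)) (1^n≈1 n)

  fermat : ∀ a → a ^ p ≈ a
  fermat a = begin
    a ^ p           ≈⟨ ^-congˡ p (residue≈ a) ⟨
    (+ residue a) ^ p ≈⟨ fermat-ℕ (residue a) ⟩
    + residue a     ≈⟨ residue≈ a ⟩
    a               ∎
    where
    fermat-ℕ : ∀ n → (+ n) ^ p ≈ + n
    fermat-ℕ zero    = ≡.subst (λ n → 0ℤ ^ n ≈ 0ℤ) (ℕP.suc-pred p) ≈-refl
    fermat-ℕ (suc n) = ≈-trans (frobenius characteristic 1ℤ (+ n)) (+-cong (1^n≈1 p) (fermat-ℕ n))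

  fermat-unit : ∀ {a} → ¬ a ≈ 0ℤ → a ^ (p ℕ.∸ 1) ≈ 1ℤ
  fermat-unit {a} a≉0 = *-cancelˡ a≉0 (begin
    a ℤ.* a ^ (p ℕ.∸ 1) ≡⟨⟩
    a ^ suc (p ℕ.∸ 1)   ≈⟨ ^-congʳ a (ℕP.suc-pred p) ⟩
    a ^ p               ≈⟨ fermat a ⟩
    a                   ≡⟨ ℤP.*-identityʳ a ⟨
    a ℤ.* 1ℤ            ∎)

  infix 8 _⁻¹
  _⁻¹ : ℤ → ℤ
  a ⁻¹ = a ^ (p ℕ.∸ 2)

  *-inverseʳ : ∀ {a} → ¬ a ≈ 0ℤ → a ℤ.* a ⁻¹ ≈ 1ℤ
  *-inverseʳ {a} a≉0 = ≈-trans (^-congʳ a (≡.sym (ℕP.+-∸-assoc 1 1<p))) (fermat-unit a≉0)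

module FiniteProduct where
  open import Data.Product using (_×_)

  ∏ : (ℕ → Bool) → ℕ → ℤ
  ∏ S zero    = 1ℤ
  ∏ S (suc n) = if S n then + n ℤ.* ∏ S n else ∏ S n

  size : (ℕ → Bool) → ℕ → ℕ
  size S zero    = 0
  size S (suc n) = if S n then suc (size S n) else size S n

  infixl 6 _─_
  _─_ : (ℕ → Bool) → ℕ → ℕ → Bool
  (S ─ y₀) y with y ℕ.≟ y₀
  ... | yes _ = false
  ... | no  _ = S y

  ─-removed : ∀ S y₀ → (S ─ y₀) y₀ ≡ false
  ─-removed S y₀ with y₀ ℕ.≟ y₀
  ... | yes _   = ≡.refl
  ... | no  y≢y = ⊥-elim (y≢y ≡.refl)

  ─-kept : ∀ S {y₀ y} → y ≢ y₀ → (S ─ y₀) y ≡ S y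
  ─-kept S {y₀} {y} y≢y₀ with y ℕ.≟ y₀
  ... | yes y≡y₀ = ⊥-elim (y≢y₀ y≡y₀)
  ... | no  _    = ≡.refl

  ─-member : ∀ S {y₀ y} → (S ─ y₀) y ≡ true → y ≢ y₀ × S y ≡ true
  ─-member S {y₀} {y} Sy with y ℕ.≟ y₀
  ─-member S () | yes _
  ... | no y≢y₀ = y≢y₀ , Sy

  ∏-cong : ∀ {S S′} n → (∀ {y} → y < n → S y ≡ S′ y) → ∏ S n ≡ ∏ S′ n
  ∏-cong zero    _    = ≡.refl
  ∏-cong (suc n) S≡S′ rewrite S≡S′ (ℕP.n<1+n n) | ∏-cong n (λ y<n → S≡S′ (ℕP.m<n⇒m<1+n y<n)) = ≡.refl

  size-cong : ∀ {S S′} n → (∀ {y} → y < n → S y ≡ S′ y) → size S n ≡ size S′ n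
  size-cong zero    _    = ≡.refl
  size-cong (suc n) S≡S′ rewrite S≡S′ (ℕP.n<1+n n) | size-cong n (λ y<n → S≡S′ (ℕP.m<n⇒m<1+n y<n)) = ≡.refl

  ∏-─ : ∀ S {y₀} n → S y₀ ≡ true → y₀ < n → ∏ S n ≡ + y₀ ℤ.* ∏ (S ─ y₀) n
  ∏-─ S {y₀} (suc n) Sy₀ y₀<1+n with ℕP.m<1+n⇒m<n∨m≡n y₀<1+n
  ... | inj₂ ≡.refl rewrite Sy₀ | ─-removed S y₀ = cong (+ y₀ ℤ.*_) (∏-cong y₀ (λ y<y₀ → ≡.sym (─-kept S (ℕP.<⇒≢ y<y₀))))
  ... | inj₁ y₀<n rewrite ─-kept S {y₀} {n} (ℕP.>⇒≢ y₀<n) | ∏-─ S n Sy₀ y₀<n with S n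
  ...   | true  = swap (+ n) (+ y₀) (∏ (S ─ y₀) n)
    where
    swap : ∀ a b c → a ℤ.* (b ℤ.* c) ≡ b ℤ.* (a ℤ.* c)
    swap = solve-∀
  ...   | false = ≡.refl

  size-─ : ∀ S {y₀} n → S y₀ ≡ true → y₀ < n → size S n ≡ suc (size (S ─ y₀) n)
  size-─ S {y₀} (suc n) Sy₀ y₀<1+n with ℕP.m<1+n⇒m<n∨m≡n y₀<1+n
  ... | inj₂ ≡.refl rewrite Sy₀ | ─-removed S y₀ = cong suc (size-cong y₀ (λ y<y₀ → ≡.sym (─-kept S (ℕP.<⇒≢ y<y₀))))
  ... | inj₁ y₀<n rewrite ─-kept S {y₀} {n} (ℕP.>⇒≢ y₀<n) | size-─ S n Sy₀ y₀<n with S n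
  ...   | true  = ≡.refl
  ...   | false = ≡.refl

  size≡0⇒∏≡1 : ∀ S n → size S n ≡ 0 → ∏ S n ≡ 1ℤ
  size≡0⇒∏≡1 S zero    _ = ≡.refl
  size≡0⇒∏≡1 S (suc n) size≡0 with S n
  size≡0⇒∏≡1 S (suc n) () | true
  ... | false = size≡0⇒∏≡1 S n size≡0

  size≢0⇒member : ∀ S n → size S n ≢ 0 → Σ ℕ λ y → y < n × S y ≡ true
  size≢0⇒member S zero    size≢0 = ⊥-elim (size≢0 ≡.refl)
  size≢0⇒member S (suc n) size≢0 with S n in Sn
  ... | true  = n , ℕP.n<1+n n , Sn
  ... | false with size≢0⇒member S n size≢0
  ...   | y , y<n , Sy = y , ℕP.m<n⇒m<1+n y<n , Sy

-- Euler's criterion via Wilson-style pairing: for c ≢ 0, y ↦ c/y is an involution of the units whose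
-- fixed points are the square roots of c, and each orbit {y, c/y} contributes c to the product of all units.
module EulerCriterion (p h : ℕ) (p-prime : Prime p) (p≡1+2h : p ≡ suc (h ℕ.+ h)) where
  open import Data.Product using (_×_)
  open PrimeField p p-prime
  open FiniteProduct
  open import Relation.Binary.Reasoning.Setoid ≈-setoid

  -- The property that legendreℤ decides.
  IsSquare : ℤ → Set
  IsSquare c = Σ (Fin p) λ y → p ℕ∣.∣ ℤ.∣ (+ toℕ y) ℤ.* (+ toℕ y) ℤ.- c ∣

  square⇒IsSquare : ∀ {y c} → y < p → + y ℤ.* + y ≈ c → IsSquare c
  square⇒IsSquare {y} {c} y<p y²≈c =
    fromℕ< y<p , ≡.subst (λ r → p ℕ∣.∣ ℤ.∣ + r ℤ.* + r ℤ.- c ∣) (≡.sym (toℕ-fromℕ< y<p)) (≈⇒∣ y²≈c)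

  positive≉0 : ∀ {y} → 0 < y → y < p → ¬ + y ≈ 0ℤ
  positive≉0 {y} 0<y y<p y≈0 with residue-unique y≈0 y<p (ℕP.≤-<-trans z≤n y<p)
  ... | ≡.refl = ℕP.<-irrefl ≡.refl 0<y

  ≉0⇒positive : ∀ {y} → ¬ + y ≈ 0ℤ → 0 < y
  ≉0⇒positive {zero}  y≉0 = ⊥-elim (y≉0 ≈-refl)
  ≉0⇒positive {suc y} _   = s≤s z≤n

  0<h : 0 < h
  0<h = ℕP.n≢0⇒n>0 λ h≡0 → ℕP.<-irrefl (≡.sym (≡.trans p≡1+2h (cong (λ n → suc (n ℕ.+ n)) h≡0))) 1<p

  2<p : 2 < p
  2<p = ≡.subst (2 <_) (≡.sym p≡1+2h) (s≤s (ℕP.+-mono-≤ 0<h 0<h))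

  module Pairing (c : ℤ) (c≉0 : ¬ c ≈ 0ℤ) where

    σ : ℕ → ℕ
    σ y = residue (c ℤ.* (+ y) ⁻¹)

    σ<p : ∀ y → σ y < p
    σ<p y = residue<p (c ℤ.* (+ y) ⁻¹)

    y*σy≈c : ∀ {y} → 0 < y → y < p → + y ℤ.* + σ y ≈ c
    y*σy≈c {y} 0<y y<p = begin
      + y ℤ.* + σ y               ≈⟨ *-congˡ {+ y} (residue≈ (c ℤ.* (+ y) ⁻¹)) ⟩
      + y ℤ.* (c ℤ.* (+ y) ⁻¹)    ≡⟨ swap (+ y) c ((+ y) ⁻¹) ⟩
      c ℤ.* (+ y ℤ.* (+ y) ⁻¹)    ≈⟨ *-congˡ {c} (*-inverseʳ (positive≉0 0<y y<p)) ⟩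
      c ℤ.* 1ℤ                    ≡⟨ ℤP.*-identityʳ c ⟩
      c                           ∎
      where
      swap : ∀ a b d → a ℤ.* (b ℤ.* d) ≡ b ℤ.* (a ℤ.* d)
      swap = solve-∀

    σ-positive : ∀ {y} → 0 < y → y < p → 0 < σ y
    σ-positive {y} 0<y y<p = ≉0⇒positive λ σy≈0 →
      c≉0 (≈-trans (≈-sym (y*σy≈c 0<y y<p)) (≈-trans (*-congˡ {+ y} σy≈0) (≡⇒≈ (ℤP.*-zeroʳ (+ y)))))

    σ-involutive : ∀ {y} → 0 < y → y < p → σ (σ y) ≡ y
    σ-involutive {y} 0<y y<p = residue-unique (*-cancelˡ (positive≉0 0<σy (σ<p y)) σy*σσy≈σy*y) (σ<p (σ y)) y<p
      where
      0<σy : 0 < σ y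
      0<σy = σ-positive 0<y y<p
      σy*σσy≈σy*y : + σ y ℤ.* + σ (σ y) ≈ + σ y ℤ.* + y
      σy*σσy≈σy*y = ≈-trans (y*σy≈c 0<σy (σ<p y)) (≈-trans (≈-sym (y*σy≈c 0<y y<p)) (≡⇒≈ (ℤP.*-comm (+ y) (+ σ y))))

    σ-injective : ∀ {y z} → 0 < y → y < p → 0 < z → z < p → σ y ≡ σ z → y ≡ z
    σ-injective 0<y y<p 0<z z<p σy≡σz =
      ≡.trans (≡.sym (σ-involutive 0<y y<p)) (≡.trans (cong σ σy≡σz) (σ-involutive 0<z z<p))

    σ-fixed⇒square : ∀ {y} → 0 < y → y < p → σ y ≡ y → + y ℤ.* + y ≈ c
    σ-fixed⇒square {y} 0<y y<p σy≡y = ≡.subst (λ r → + y ℤ.* + r ≈ c) σy≡y (y*σy≈c 0<y y<p)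

    square⇒σ-fixed : ∀ {y} → 0 < y → y < p → + y ℤ.* + y ≈ c → σ y ≡ y
    square⇒σ-fixed {y} 0<y y<p y²≈c = residue-unique
      (*-cancelˡ (positive≉0 0<y y<p) (≈-trans (y*σy≈c 0<y y<p) (≈-sym y²≈c))) (σ<p y) y<p

    σ-avoids-fixed : ∀ {y w} → 0 < y → y < p → σ w ≡ w → y ≢ w → σ y ≢ w
    σ-avoids-fixed 0<y y<p σw≡w y≢w σy≡w =
      y≢w (≡.trans (≡.sym (σ-involutive 0<y y<p)) (≡.trans (cong σ σy≡w) σw≡w))

    record Paired (S : ℕ → Bool) : Set where
      field
        positive         : ∀ {y} → y < p → S y ≡ true → 0 < y
        closed           : ∀ {y} → y < p → S y ≡ true → S (σ y) ≡ true
        fixed-point-free : ∀ {y} → y < p → S y ≡ true → σ y ≢ y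

    Paired-─ : ∀ {S y} → Paired S → y < p → S y ≡ true → Paired ((S ─ y) ─ σ y)
    Paired-─ {S} {y} paired y<p Sy = record
      { positive         = λ z<p S₂z → positive z<p (proj₂ (proj₂ (unpack S₂z)))
      ; closed           = closed₂
      ; fixed-point-free = λ z<p S₂z → fixed-point-free z<p (proj₂ (proj₂ (unpack S₂z)))
      }
      where
      open Paired paired
      unpack : ∀ {z} → ((S ─ y) ─ σ y) z ≡ true → z ≢ σ y × z ≢ y × S z ≡ true
      unpack S₂z = let z≢σy , S₁z = ─-member (S ─ y) S₂z
                       z≢y  , Sz  = ─-member S S₁z
                   in z≢σy , z≢y , Sz
      closed₂ : ∀ {z} → z < p → ((S ─ y) ─ σ y) z ≡ true → ((S ─ y) ─ σ y) (σ z) ≡ true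
      closed₂ {z} z<p S₂z =
        let z≢σy , z≢y , Sz = unpack S₂z
            0<z = positive z<p Sz in
        ≡.trans (─-kept (S ─ y) (λ σz≡σy → z≢y (σ-injective 0<z z<p (positive y<p Sy) y<p σz≡σy)))
          (≡.trans (─-kept S (λ σz≡y → z≢σy (≡.trans (≡.sym (σ-involutive 0<z z<p)) (cong σ σz≡y)))) (closed z<p Sz))

    ∏-paired : ∀ k S → size S p ≡ k ℕ.+ k → Paired S → ∏ S p ≈ c ^ k
    ∏-paired zero    S size≡0 _ = ≡⇒≈ (size≡0⇒∏≡1 S p size≡0)
    ∏-paired (suc k) S size≡2k+2 paired = begin
      ∏ S p                             ≡⟨ ∏-─ S p Sy y<p ⟩
      + y ℤ.* ∏ (S ─ y) p               ≡⟨ cong (+ y ℤ.*_) (∏-─ (S ─ y) p S₁σy (σ<p y)) ⟩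
      + y ℤ.* (+ σ y ℤ.* ∏ S₂ p)        ≈⟨ *-congˡ {+ y} (*-congˡ {+ σ y} (∏-paired k S₂ size₂ (Paired-─ paired y<p Sy))) ⟩
      + y ℤ.* (+ σ y ℤ.* c ^ k)         ≡⟨ ℤP.*-assoc (+ y) (+ σ y) (c ^ k) ⟨
      + y ℤ.* + σ y ℤ.* c ^ k           ≈⟨ *-congʳ {c ^ k} (y*σy≈c (positive y<p Sy) y<p) ⟩
      c ℤ.* c ^ k                       ∎
      where
      open Paired paired
      size≡2+2k : size S p ≡ suc (suc (k ℕ.+ k))
      size≡2+2k = ≡.trans size≡2k+2 (cong suc (ℕP.+-suc k k))
      member : Σ ℕ λ y → y < p × S y ≡ true
      member = size≢0⇒member S p (λ size≡0 → ℕP.0≢1+n (≡.trans (≡.sym size≡0) size≡2+2k))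
      y : ℕ
      y = proj₁ member
      y<p : y < p
      y<p = proj₁ (proj₂ member)
      Sy : S y ≡ true
      Sy = proj₂ (proj₂ member)
      S₂ : ℕ → Bool
      S₂ = (S ─ y) ─ σ y
      S₁σy : (S ─ y) (σ y) ≡ true
      S₁σy = ≡.trans (─-kept S (fixed-point-free y<p Sy)) (closed y<p Sy)
      size₂ : size S₂ p ≡ k ℕ.+ k
      size₂ = ℕP.suc-injective (ℕP.suc-injective (≡.trans (cong suc (≡.sym (size-─ (S ─ y) p S₁σy (σ<p y))))
                (≡.trans (≡.sym (size-─ S p Sy y<p)) size≡2+2k)))

  private
    m+m≢1+n+n : ∀ m n → m ℕ.+ m ≢ suc (n ℕ.+ n)
    m+m≢1+n+n zero    n       ()
    m+m≢1+n+n (suc m) zero    eq = ℕP.0≢1+n (≡.sym (≡.trans (≡.sym (ℕP.+-suc m m)) (ℕP.suc-injective eq)))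
    m+m≢1+n+n (suc m) (suc n) eq = m+m≢1+n+n m n
      (ℕP.suc-injective (≡.trans (≡.sym (ℕP.+-suc m m)) (≡.trans (ℕP.suc-injective eq) (cong suc (ℕP.+-suc n n)))))

  units : ℕ → Bool
  units zero    = false
  units (suc _) = true

  units-positive : ∀ {y} → units y ≡ true → 0 < y
  units-positive {suc y} _ = s≤s z≤n

  positive-unit : ∀ {y} → 0 < y → units y ≡ true
  positive-unit {suc y} _ = ≡.refl

  size-units : size units p ≡ h ℕ.+ h
  size-units = ≡.subst (λ n → size units n ≡ h ℕ.+ h) (≡.sym p≡1+2h) (count (h ℕ.+ h))
    where
    count : ∀ n → size units (suc n) ≡ n
    count zero    = ≡.refl
    count (suc n) = cong suc (count n)

  ∏units-nonresidue : ∀ {c} → ¬ c ≈ 0ℤ → ¬ IsSquare c → ∏ units p ≈ c ^ h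
  ∏units-nonresidue {c} c≉0 ¬□c = ∏-paired h units size-units record
    { positive         = λ _ → units-positive
    ; closed           = λ y<p unit → positive-unit (σ-positive (units-positive unit) y<p)
    ; fixed-point-free = λ y<p unit σy≡y → ¬□c (square⇒IsSquare y<p (σ-fixed⇒square (units-positive unit) y<p σy≡y))
    }
    where open Pairing c c≉0

  p∸r≈-r : ∀ {r} → r ℕ.≤ p → + (p ℕ.∸ r) ≈ ℤ.- + r
  p∸r≈-r {r} r≤p = x-y≈0⇒x≈y (begin
    + (p ℕ.∸ r) ℤ.- ℤ.- + r   ≡⟨ cong (ℤ._+_ (+ (p ℕ.∸ r))) (ℤP.neg-involutive (+ r)) ⟩
    + (p ℕ.∸ r) ℤ.+ + r       ≡⟨ cong +_ (ℕP.m∸n+n≡m r≤p) ⟩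
    + p                       ≡⟨ ℤP.*-identityˡ (+ p) ⟨
    1ℤ ℤ.* + p                ≈⟨ multiple≈0 1ℤ ⟩
    0ℤ                        ∎)

  square-roots : ∀ {r z} → 0 < r → r < p → z < p → + z ℤ.* + z ≈ + r ℤ.* + r → (z ≡ r) ⊎ (z ≡ p ℕ.∸ r)
  square-roots {r} {z} 0<r r<p z<p z²≈r² with ≈0-product (≈-trans (≡⇒≈ (difference-of-squares (+ z) (+ r))) (x≈y⇒x-y≈0 z²≈r²))
    where
    difference-of-squares : ∀ a b → (a ℤ.- b) ℤ.* (a ℤ.+ b) ≡ a ℤ.* a ℤ.- b ℤ.* b
    difference-of-squares = solve-∀
  ... | inj₁ z-r≈0 = inj₁ (residue-unique (x-y≈0⇒x≈y z-r≈0) z<p r<p)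
  ... | inj₂ z+r≈0 = inj₂ (residue-unique z≈p∸r z<p (ℕP.∸-monoʳ-< 0<r (ℕP.<⇒≤ r<p)))
    where
    z≈p∸r : + z ≈ + (p ℕ.∸ r)
    z≈p∸r = ≈-trans (x-y≈0⇒x≈y (≈-trans (≡⇒≈ (cong (ℤ._+_ (+ z)) (ℤP.neg-involutive (+ r)))) z+r≈0))
                    (≈-sym (p∸r≈-r (ℕP.<⇒≤ r<p)))

  -- For c = r², the fixed points of σ are r and p - r; removing them leaves a paired set.
  module SquareRoots {c} (c≉0 : ¬ c ≈ 0ℤ) {r} (r<p : r < p) (r²≈c : + r ℤ.* + r ≈ c) where
    open Pairing c c≉0

    0<r : 0 < r
    0<r = ≉0⇒positive λ r≈0 → c≉0 (≈-trans (≈-sym r²≈c) (*-congʳ {+ r} r≈0))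

    r′ : ℕ
    r′ = p ℕ.∸ r

    r′<p : r′ < p
    r′<p = ℕP.∸-monoʳ-< 0<r (ℕP.<⇒≤ r<p)

    r′≈-r : + r′ ≈ ℤ.- + r
    r′≈-r = p∸r≈-r (ℕP.<⇒≤ r<p)

    r′≢r : r′ ≢ r
    r′≢r r′≡r = m+m≢1+n+n r h (≡.trans (cong (ℕ._+ r) (≡.sym r′≡r)) (≡.trans (ℕP.m∸n+n≡m (ℕP.<⇒≤ r<p)) p≡1+2h))

    σr′≡r′ : σ r′ ≡ r′
    σr′≡r′ = square⇒σ-fixed (ℕP.m<n⇒0<n∸m r<p) r′<p (≈-trans (*-cong r′≈-r r′≈-r) (≈-trans (≡⇒≈ (neg*neg (+ r))) r²≈c))
      where
      neg*neg : ∀ a → ℤ.- a ℤ.* ℤ.- a ≡ a ℤ.* a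
      neg*neg = solve-∀

    non-roots : ℕ → Bool
    non-roots = (units ─ r) ─ r′

    without-r-has-r′ : (units ─ r) r′ ≡ true
    without-r-has-r′ = ≡.trans (─-kept units r′≢r) (positive-unit (ℕP.m<n⇒0<n∸m r<p))

    size-non-roots : size non-roots p ≡ (h ℕ.∸ 1) ℕ.+ (h ℕ.∸ 1)
    size-non-roots = ℕP.suc-injective (ℕP.suc-injective (≡.trans (cong suc (≡.sym (size-─ (units ─ r) p without-r-has-r′ r′<p)))
                       (≡.trans (≡.sym (size-─ units p (positive-unit 0<r) r<p)) (≡.trans size-units h+h≡2+k+k))))
      where
      h+h≡2+k+k : h ℕ.+ h ≡ suc (suc ((h ℕ.∸ 1) ℕ.+ (h ℕ.∸ 1)))
      h+h≡2+k+k = ≡.trans (cong (λ n → n ℕ.+ n) (≡.sym (ℕP.suc-pred h {{ℕ.>-nonZero 0<h}})))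
                          (cong suc (ℕP.+-suc (h ℕ.∸ 1) (h ℕ.∸ 1)))

    non-roots-paired : Paired non-roots
    non-roots-paired = record
      { positive         = λ _ S₂z → proj₂ (proj₂ (unpack S₂z))
      ; closed           = closed₂
      ; fixed-point-free = fixed-point-free₂
      }
      where
      unpack : ∀ {z} → non-roots z ≡ true → z ≢ r′ × z ≢ r × 0 < z
      unpack S₂z = let z≢r′ , S₁z = ─-member (units ─ r) S₂z
                       z≢r  , unit = ─-member units S₁z
                   in z≢r′ , z≢r , units-positive unit
      closed₂ : ∀ {z} → z < p → non-roots z ≡ true → non-roots (σ z) ≡ true
      closed₂ {z} z<p S₂z =
        let z≢r′ , z≢r , 0<z = unpack S₂z in
        ≡.trans (─-kept (units ─ r) (σ-avoids-fixed {w = r′} 0<z z<p σr′≡r′ z≢r′))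
          (≡.trans (─-kept units (σ-avoids-fixed {w = r} 0<z z<p (square⇒σ-fixed 0<r r<p r²≈c) z≢r))
            (positive-unit (σ-positive 0<z z<p)))
      fixed-point-free₂ : ∀ {z} → z < p → non-roots z ≡ true → σ z ≢ z
      fixed-point-free₂ {z} z<p S₂z σz≡z =
        let z≢r′ , z≢r , 0<z = unpack S₂z in
        [ z≢r , z≢r′ ]′ (square-roots 0<r r<p z<p (≈-trans (σ-fixed⇒square 0<z z<p σz≡z) (≈-sym r²≈c)))

  ∏units-residue : ∀ {c} → ¬ c ≈ 0ℤ → IsSquare c → ∏ units p ≈ ℤ.- (c ^ h)
  ∏units-residue {c} c≉0 (y , p∣y²-c) = begin
    ∏ units p                              ≡⟨ ∏-─ units p (positive-unit 0<r) r<p ⟩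
    + r ℤ.* ∏ (units ─ r) p                ≡⟨ cong (+ r ℤ.*_) (∏-─ (units ─ r) p without-r-has-r′ r′<p) ⟩
    + r ℤ.* (+ r′ ℤ.* ∏ non-roots p)       ≈⟨ *-congˡ {+ r} (*-cong r′≈-r
                                                (∏-paired (h ℕ.∸ 1) non-roots size-non-roots non-roots-paired)) ⟩
    + r ℤ.* (ℤ.- + r ℤ.* c ^ (h ℕ.∸ 1))    ≡⟨ rearrange (+ r) (c ^ (h ℕ.∸ 1)) ⟩
    ℤ.- (+ r ℤ.* + r ℤ.* c ^ (h ℕ.∸ 1))    ≈⟨ -‿cong (*-congʳ {c ^ (h ℕ.∸ 1)} r²≈c) ⟩
    ℤ.- (c ^ suc (h ℕ.∸ 1))                ≈⟨ -‿cong (^-congʳ c (ℕP.suc-pred h {{ℕ.>-nonZero 0<h}})) ⟩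
    ℤ.- (c ^ h)                            ∎
    where
    r : ℕ
    r = toℕ y
    r<p : r < p
    r<p = toℕ<n y
    r²≈c : + r ℤ.* + r ≈ c
    r²≈c = ∣⇒≈ p∣y²-c
    open Pairing c c≉0
    open SquareRoots c≉0 r<p r²≈c
    rearrange : ∀ a b → a ℤ.* (ℤ.- a ℤ.* b) ≡ ℤ.- (a ℤ.* a ℤ.* b)
    rearrange = solve-∀

  wilson : ∏ units p ≈ ℤ.- 1ℤ
  wilson = ≈-trans (∏units-residue (positive≉0 (s≤s z≤n) 1<p) (square⇒IsSquare 1<p ≈-refl)) (-‿cong (1^n≈1 h))

  euler : ∀ c → legendreℤ p c ≈ c ^ h
  euler c with p ∣? ℤ.∣ c ∣
  ... | yes p∣c = ≈-sym (≈-trans (^-congˡ h (∣⇒≈0 p∣c)) 0^h≈0)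
    where
    0^h≈0 : 0ℤ ^ h ≈ 0ℤ
    0^h≈0 = ≡.subst (λ n → 0ℤ ^ n ≈ 0ℤ) (ℕP.suc-pred h {{ℕ.>-nonZero 0<h}}) ≈-refl
  ... | no p∤c with any? {n = p} (λ y → p ∣? ℤ.∣ (+ toℕ y) ℤ.* (+ toℕ y) ℤ.- c ∣)
  ...   | yes □c = ≈-trans (≈-sym (≡⇒≈ (ℤP.neg-involutive 1ℤ)))
                  (≈-trans (-‿cong (≈-trans (≈-sym wilson) (∏units-residue c≉0 □c))) (≡⇒≈ (ℤP.neg-involutive (c ^ h))))
    where
    c≉0 : ¬ c ≈ 0ℤ
    c≉0 c≈0 = p∤c (≈0⇒∣ c≈0)
  ...   | no ¬□c = ≈-trans (≈-sym wilson) (∏units-nonresidue (λ c≈0 → p∤c (≈0⇒∣ c≈0)) ¬□c)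

wℤ : ℕ → ℤ → ℤ
wℤ zero          t = 1ℤ
wℤ (suc zero)    t = 1ℤ ℤ.+ + 2 ℤ.* t
wℤ (suc (suc n)) t = + 2 ℤ.* t ℤ.* wℤ (suc n) t ℤ.- wℤ n t

-- ℤ/p[α, β] with α² = 1 + z and β² = z - 1; for z = cos θ these are 2cos²(θ/2) and -2sin²(θ/2).
module HalfAngle (p : ℕ) (z : ℤ) where
  module F where
    open Congruence p public
    open import Relation.Binary.Reasoning.Setoid ≈-setoid public
    open import Algebra.Properties.Monoid.Mult (CommutativeSemiring.+-monoid commutativeSemiring) public using (_×_)

  a b : ℤ
  a = 1ℤ ℤ.+ z
  b = z ℤ.- 1ℤ

  private
    module L = Adjoin F.commutativeSemiring a
    module K = Adjoin L.commutativeSemiring (L.ι b)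

  commutativeSemiring : CommutativeSemiring 0ℓ 0ℓ
  commutativeSemiring = K.commutativeSemiring

  open CommutativeSemiring commutativeSemiring public
  open import Algebra.Solver.Ring.NaturalCoefficients.Default commutativeSemiring
  open import Relation.Binary.Reasoning.Setoid setoid
  open import Algebra.Properties.Semiring.Exp semiring public using (_^_; ^-homo-*; ^-congˡ; ^-assocʳ)
  open import Algebra.Properties.CommutativeSemiring.Exp commutativeSemiring using (^-distrib-*)
  open import Algebra.Properties.Monoid.Mult +-monoid using (_×_)

  ι : ℤ → Carrier
  ι = K.ι ∘ L.ι

  α β γ : Carrier
  α = K.ι L.√d
  β = K.√d
  γ = α * β

  -- The coefficient of αβ.
  c₃ : Carrier → ℤ
  c₃ = proj₂ ∘ proj₂

  even odd : ℤ → ℤ → Carrier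
  even u v = ι u + ι v * γ
  odd  u v = ι u * α + ι v * β

  ι-cong : ∀ {x y} → x F.≈ y → ι x ≈ ι y
  ι-cong = K.ι-cong ∘ L.ι-cong

  ι-+ : ∀ x y → ι (x ℤ.+ y) ≈ ι x + ι y
  ι-+ x y = trans (K.ι-cong (L.ι-+ x y)) (K.ι-+ (L.ι x) (L.ι y))

  ι-* : ∀ x y → ι (x ℤ.* y) ≈ ι x * ι y
  ι-* x y = trans (K.ι-cong (L.ι-* x y)) (K.ι-* (L.ι x) (L.ι y))

  ι-^ : ∀ x n → ι (x F.^ n) ≈ ι x ^ n
  ι-^ x n = trans (K.ι-cong (L.ι-^ x n)) (K.ι-^ (L.ι x) n)

  characteristic : ∀ {q} → (∀ x → q F.× x F.≈ 0ℤ) → ∀ x → q × x ≈ 0#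
  characteristic {q} char = K.characteristic {q} (L.characteristic {q} char)

  ι-*-* : ∀ x y w → ι (x ℤ.* y ℤ.* w) ≈ ι x * ι y * ι w
  ι-*-* x y w = trans (ι-* (x ℤ.* y) w) (*-cong (ι-* x y) refl)

  ι-*-+-* : ∀ x y v w → ι (x ℤ.* y ℤ.+ v ℤ.* w) ≈ ι x * ι y + ι v * ι w
  ι-*-+-* x y v w = trans (ι-+ (x ℤ.* y) (v ℤ.* w)) (+-cong (ι-* x y) (ι-* v w))

  even-cong : ∀ {u u′ v v′} → u F.≈ u′ → v F.≈ v′ → even u v ≈ even u′ v′
  even-cong u≈u′ v≈v′ = +-cong (ι-cong u≈u′) (*-cong (ι-cong v≈v′) refl)

  odd-cong : ∀ {u u′ v v′} → u F.≈ u′ → v F.≈ v′ → odd u v ≈ odd u′ v′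
  odd-cong u≈u′ v≈v′ = +-cong (*-cong (ι-cong u≈u′) refl) (*-cong (ι-cong v≈v′) refl)

  α²≈ιa : α * α ≈ ι a
  α²≈ιa = trans (sym (K.ι-* L.√d L.√d)) (K.ι-cong L.√d²≋ιd)

  β²≈ιb : β * β ≈ ι b
  β²≈ιb = K.√d²≋ιd

  γ²≈ιab : γ * γ ≈ ι (a ℤ.* b)
  γ²≈ιab = begin
    (α * β) * (α * β)   ≈⟨ solve 2 (λ α β → (α :* β) :* (α :* β) := (α :* α) :* (β :* β)) refl α β ⟩
    (α * α) * (β * β)   ≈⟨ *-cong α²≈ιa β²≈ιb ⟩
    ι a * ι b           ≈⟨ ι-* a b ⟨
    ι (a ℤ.* b)         ∎

  c₃-cong : ∀ {x y} → x ≈ y → c₃ x F.≈ c₃ y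
  c₃-cong x≈y = L._≋_.im (K._≋_.im x≈y)

  c₃-+ : ∀ x y → c₃ (x + y) F.≈ c₃ x ℤ.+ c₃ y
  c₃-+ x y = F.≈-trans (L._≋_.im (K._≋_.im (K.⊕-coordinatewise x y))) (L._≋_.im (L.⊕-coordinatewise (proj₂ x) (proj₂ y)))

  c₃-ι* : ∀ r x → c₃ (ι r * x) F.≈ r ℤ.* c₃ x
  c₃-ι* r x = F.≈-trans (L._≋_.im (K.im-ι⊗ (L.ι r) x)) (L.im-ι⊗ r (proj₂ x))

  c₃-even : ∀ u v → c₃ (even u v) F.≈ v
  c₃-even u v = F.≈-trans (c₃-+ (ι u) (ι v * γ)) (F.≈-trans (F.+-congˡ {0ℤ} (F.≈-trans (c₃-ι* v γ) (F.*-congˡ {v} c₃γ≈1)))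
                  (F.≡⇒≈ (tidy v)))
    where
    c₃γ≈1 : c₃ γ F.≈ 1ℤ
    c₃γ≈1 = F.≈-trans (L._≋_.im (K._≋_.im (K.ι⊗√d L.√d))) F.≈-refl
    tidy : ∀ v → 0ℤ ℤ.+ v ℤ.* 1ℤ ≡ v
    tidy = solve-∀

  odd*odd : ∀ u v u′ v′ → odd u v * odd u′ v′ ≈ even (u ℤ.* u′ ℤ.* a ℤ.+ v ℤ.* v′ ℤ.* b) (u ℤ.* v′ ℤ.+ v ℤ.* u′)
  odd*odd u v u′ v′ = begin
    (ι u * α + ι v * β) * (ι u′ * α + ι v′ * β)
      ≈⟨ solve 6 (λ U V U′ V′ α β → (U :* α :+ V :* β) :* (U′ :* α :+ V′ :* β)
                   := U :* U′ :* (α :* α) :+ V :* V′ :* (β :* β) :+ (U :* V′ :+ V :* U′) :* (α :* β))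
                 refl (ι u) (ι v) (ι u′) (ι v′) α β ⟩
    ι u * ι u′ * (α * α) + ι v * ι v′ * (β * β) + (ι u * ι v′ + ι v * ι u′) * γ
      ≈⟨ +-cong (+-cong (*-cong refl α²≈ιa) (*-cong refl β²≈ιb)) refl ⟩
    ι u * ι u′ * ι a + ι v * ι v′ * ι b + (ι u * ι v′ + ι v * ι u′) * γ
      ≈⟨ +-cong (+-cong (ι-*-* u u′ a) (ι-*-* v v′ b)) (*-cong (ι-*-+-* u v′ v u′) refl) ⟨
    ι (u ℤ.* u′ ℤ.* a) + ι (v ℤ.* v′ ℤ.* b) + ι (u ℤ.* v′ ℤ.+ v ℤ.* u′) * γ
      ≈⟨ +-cong (ι-+ _ _) refl ⟨
    even (u ℤ.* u′ ℤ.* a ℤ.+ v ℤ.* v′ ℤ.* b) (u ℤ.* v′ ℤ.+ v ℤ.* u′) ∎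

  even*even : ∀ u v u′ v′ → even u v * even u′ v′ ≈ even (u ℤ.* u′ ℤ.+ v ℤ.* v′ ℤ.* (a ℤ.* b)) (u ℤ.* v′ ℤ.+ v ℤ.* u′)
  even*even u v u′ v′ = begin
    (ι u + ι v * γ) * (ι u′ + ι v′ * γ)
      ≈⟨ solve 5 (λ U V U′ V′ γ → (U :+ V :* γ) :* (U′ :+ V′ :* γ)
                   := U :* U′ :+ V :* V′ :* (γ :* γ) :+ (U :* V′ :+ V :* U′) :* γ)
                 refl (ι u) (ι v) (ι u′) (ι v′) γ ⟩
    ι u * ι u′ + ι v * ι v′ * (γ * γ) + (ι u * ι v′ + ι v * ι u′) * γ
      ≈⟨ +-cong (+-cong (ι-* u u′) (trans (ι-*-* v v′ (a ℤ.* b)) (*-cong refl (sym γ²≈ιab)))) (*-cong (ι-*-+-* u v′ v u′) refl) ⟨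
    ι (u ℤ.* u′) + ι (v ℤ.* v′ ℤ.* (a ℤ.* b)) + ι (u ℤ.* v′ ℤ.+ v ℤ.* u′) * γ
      ≈⟨ +-cong (ι-+ _ _) refl ⟨
    even (u ℤ.* u′ ℤ.+ v ℤ.* v′ ℤ.* (a ℤ.* b)) (u ℤ.* v′ ℤ.+ v ℤ.* u′) ∎

  even*odd : ∀ u v u′ v′ → even u v * odd u′ v′ ≈ odd (u ℤ.* u′ ℤ.+ v ℤ.* v′ ℤ.* b) (u ℤ.* v′ ℤ.+ v ℤ.* u′ ℤ.* a)
  even*odd u v u′ v′ = begin
    (ι u + ι v * γ) * (ι u′ * α + ι v′ * β)
      ≈⟨ solve 6 (λ U V U′ V′ α β → (U :+ V :* (α :* β)) :* (U′ :* α :+ V′ :* β)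
                   := (U :* U′ :+ V :* V′ :* (β :* β)) :* α :+ (U :* V′ :+ V :* U′ :* (α :* α)) :* β)
                 refl (ι u) (ι v) (ι u′) (ι v′) α β ⟩
    (ι u * ι u′ + ι v * ι v′ * (β * β)) * α + (ι u * ι v′ + ι v * ι u′ * (α * α)) * β
      ≈⟨ +-cong (*-cong (+-cong refl (*-cong refl β²≈ιb)) refl) (*-cong (+-cong refl (*-cong refl α²≈ιa)) refl) ⟩
    (ι u * ι u′ + ι v * ι v′ * ι b) * α + (ι u * ι v′ + ι v * ι u′ * ι a) * β
      ≈⟨ +-cong (*-cong (trans (ι-+ _ _) (+-cong (ι-* u u′) (ι-*-* v v′ b))) refl)
                (*-cong (trans (ι-+ _ _) (+-cong (ι-* u v′) (ι-*-* v u′ a))) refl) ⟨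
    odd (u ℤ.* u′ ℤ.+ v ℤ.* v′ ℤ.* b) (u ℤ.* v′ ℤ.+ v ℤ.* u′ ℤ.* a) ∎

  ι*even : ∀ r u v → ι r * even u v ≈ even (r ℤ.* u) (r ℤ.* v)
  ι*even r u v = begin
    ι r * (ι u + ι v * γ)          ≈⟨ solve 4 (λ R U V γ → R :* (U :+ V :* γ) := R :* U :+ R :* V :* γ) refl (ι r) (ι u) (ι v) γ ⟩
    ι r * ι u + ι r * ι v * γ      ≈⟨ +-cong (ι-* r u) (*-cong (ι-* r v) refl) ⟨
    even (r ℤ.* u) (r ℤ.* v)       ∎

  t : ℤ
  t = + 2 ℤ.* z ℤ.* z ℤ.- 1ℤ

  ξ η e e′ : Carrier
  ξ  = even z 1ℤ
  η  = even t (+ 2 ℤ.* z)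
  e  = odd 1ℤ 1ℤ
  e′ = odd 1ℤ (ℤ.- 1ℤ)

  ξ²≈η : ξ * ξ ≈ η
  ξ²≈η = trans (even*even z 1ℤ z 1ℤ) (even-cong (F.≡⇒≈ (re z)) (F.≡⇒≈ (im z)))
    where
    re : ∀ z → z ℤ.* z ℤ.+ 1ℤ ℤ.* 1ℤ ℤ.* ((1ℤ ℤ.+ z) ℤ.* (z ℤ.- 1ℤ)) ≡ + 2 ℤ.* z ℤ.* z ℤ.- 1ℤ
    re = solve-∀
    im : ∀ z → z ℤ.* 1ℤ ℤ.+ 1ℤ ℤ.* z ≡ + 2 ℤ.* z
    im = solve-∀

  η²+1≈2tη : η * η + 1# ≈ ι (+ 2 ℤ.* t) * η
  η²+1≈2tη = begin
    η * η + ι 1ℤ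
      ≈⟨ +-cong (even*even t (+ 2 ℤ.* z) t (+ 2 ℤ.* z)) refl ⟩
    even (t ℤ.* t ℤ.+ + 2 ℤ.* z ℤ.* (+ 2 ℤ.* z) ℤ.* (a ℤ.* b)) (t ℤ.* (+ 2 ℤ.* z) ℤ.+ + 2 ℤ.* z ℤ.* t) + ι 1ℤ
      ≈⟨ solve 3 (λ U V G → U :+ V :* G :+ con 1 := (U :+ con 1) :+ V :* G) refl
                 (ι (t ℤ.* t ℤ.+ + 2 ℤ.* z ℤ.* (+ 2 ℤ.* z) ℤ.* (a ℤ.* b))) (ι (t ℤ.* (+ 2 ℤ.* z) ℤ.+ + 2 ℤ.* z ℤ.* t)) γ ⟩
    ι (t ℤ.* t ℤ.+ + 2 ℤ.* z ℤ.* (+ 2 ℤ.* z) ℤ.* (a ℤ.* b)) + ι 1ℤ + ι (t ℤ.* (+ 2 ℤ.* z) ℤ.+ + 2 ℤ.* z ℤ.* t) * γ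
      ≈⟨ +-cong (ι-+ _ 1ℤ) refl ⟨
    even (t ℤ.* t ℤ.+ + 2 ℤ.* z ℤ.* (+ 2 ℤ.* z) ℤ.* (a ℤ.* b) ℤ.+ 1ℤ) (t ℤ.* (+ 2 ℤ.* z) ℤ.+ + 2 ℤ.* z ℤ.* t)
      ≈⟨ even-cong (F.≡⇒≈ (re z)) (F.≡⇒≈ (im z)) ⟩
    even (+ 2 ℤ.* t ℤ.* t) (+ 2 ℤ.* t ℤ.* (+ 2 ℤ.* z))
      ≈⟨ ι*even (+ 2 ℤ.* t) t (+ 2 ℤ.* z) ⟨
    ι (+ 2 ℤ.* t) * η ∎
    where
    re : ∀ z → (+ 2 ℤ.* z ℤ.* z ℤ.- 1ℤ) ℤ.* (+ 2 ℤ.* z ℤ.* z ℤ.- 1ℤ)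
                 ℤ.+ + 2 ℤ.* z ℤ.* (+ 2 ℤ.* z) ℤ.* ((1ℤ ℤ.+ z) ℤ.* (z ℤ.- 1ℤ)) ℤ.+ 1ℤ
               ≡ + 2 ℤ.* (+ 2 ℤ.* z ℤ.* z ℤ.- 1ℤ) ℤ.* (+ 2 ℤ.* z ℤ.* z ℤ.- 1ℤ)
    re = solve-∀
    im : ∀ z → (+ 2 ℤ.* z ℤ.* z ℤ.- 1ℤ) ℤ.* (+ 2 ℤ.* z) ℤ.+ + 2 ℤ.* z ℤ.* (+ 2 ℤ.* z ℤ.* z ℤ.- 1ℤ)
               ≡ + 2 ℤ.* (+ 2 ℤ.* z ℤ.* z ℤ.- 1ℤ) ℤ.* (+ 2 ℤ.* z)
    im = solve-∀

  ξη^[n+2]+ξη^n≈2t·ξη^[n+1] : ∀ n → ξ * η ^ suc (suc n) + ξ * η ^ n ≈ ι (+ 2 ℤ.* t) * (ξ * η ^ suc n)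
  ξη^[n+2]+ξη^n≈2t·ξη^[n+1] n = begin
    ξ * (η * (η * η ^ n)) + ξ * η ^ n
      ≈⟨ solve 3 (λ ξ η H → ξ :* (η :* (η :* H)) :+ ξ :* H := ξ :* ((η :* η :+ con 1) :* H)) refl ξ η (η ^ n) ⟩
    ξ * ((η * η + 1#) * η ^ n)            ≈⟨ *-cong refl (*-cong η²+1≈2tη refl) ⟩
    ξ * ((ι (+ 2 ℤ.* t) * η) * η ^ n)
      ≈⟨ solve 4 (λ ξ η H T → ξ :* ((T :* η) :* H) := T :* (ξ :* (η :* H))) refl ξ η (η ^ n) (ι (+ 2 ℤ.* t)) ⟩
    ι (+ 2 ℤ.* t) * (ξ * (η * η ^ n))    ∎

  c₃[ξη^n]≈wₙ : ∀ n → c₃ (ξ * η ^ n) F.≈ wℤ n t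
  c₃[ξη^n]≈wₙ zero          = F.≈-trans (c₃-cong (*-identityʳ ξ)) (c₃-even z 1ℤ)
  c₃[ξη^n]≈wₙ (suc zero)    = F.≈-trans (c₃-cong (trans (*-cong refl (*-identityʳ η)) (even*even z 1ℤ t (+ 2 ℤ.* z))))
                                (F.≈-trans (c₃-even _ _) (F.≡⇒≈ (im z)))
    where
    im : ∀ z → z ℤ.* (+ 2 ℤ.* z) ℤ.+ 1ℤ ℤ.* (+ 2 ℤ.* z ℤ.* z ℤ.- 1ℤ) ≡ 1ℤ ℤ.+ + 2 ℤ.* (+ 2 ℤ.* z ℤ.* z ℤ.- 1ℤ)
    im = solve-∀
  c₃[ξη^n]≈wₙ (suc (suc n)) = F.x+y≈z⇒x≈z-y (F.begin
    c₃ (ξ * η ^ suc (suc n)) ℤ.+ wℤ n t           F.≈⟨ F.+-congˡ {c₃ (ξ * η ^ suc (suc n))} (c₃[ξη^n]≈wₙ n) ⟨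
    c₃ (ξ * η ^ suc (suc n)) ℤ.+ c₃ (ξ * η ^ n)   F.≈⟨ c₃-+ _ _ ⟨
    c₃ (ξ * η ^ suc (suc n) + ξ * η ^ n)          F.≈⟨ c₃-cong (ξη^[n+2]+ξη^n≈2t·ξη^[n+1] n) ⟩
    c₃ (ι (+ 2 ℤ.* t) * (ξ * η ^ suc n))          F.≈⟨ c₃-ι* _ _ ⟩
    + 2 ℤ.* t ℤ.* c₃ (ξ * η ^ suc n)              F.≈⟨ F.*-congˡ {+ 2 ℤ.* t} (c₃[ξη^n]≈wₙ (suc n)) ⟩
    + 2 ℤ.* t ℤ.* wℤ (suc n) t                    F.∎)

  e²≈2ξ : e * e ≈ ι (+ 2) * ξ
  e²≈2ξ = trans (odd*odd 1ℤ 1ℤ 1ℤ 1ℤ) (trans (even-cong (F.≡⇒≈ (re z)) (F.≡⇒≈ refl′)) (sym (ι*even (+ 2) z 1ℤ)))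
    where
    re : ∀ z → 1ℤ ℤ.* 1ℤ ℤ.* (1ℤ ℤ.+ z) ℤ.+ 1ℤ ℤ.* 1ℤ ℤ.* (z ℤ.- 1ℤ) ≡ + 2 ℤ.* z
    re = solve-∀
    refl′ : 1ℤ ℤ.* 1ℤ ℤ.+ 1ℤ ℤ.* 1ℤ ≡ + 2 ℤ.* 1ℤ
    refl′ = ≡.refl

  e^[m+m]≈2^m·ξ^m : ∀ m → e ^ (m ℕ.+ m) ≈ ι ((+ 2) F.^ m) * ξ ^ m
  e^[m+m]≈2^m·ξ^m zero    = sym (*-identityˡ 1#)
  e^[m+m]≈2^m·ξ^m (suc m) = begin
    e ^ (suc m ℕ.+ suc m)                    ≡⟨ ≡.cong (λ k → e ^ suc k) (ℕP.+-suc m m) ⟩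
    e * (e * e ^ (m ℕ.+ m))                  ≈⟨ *-assoc e e _ ⟨
    (e * e) * e ^ (m ℕ.+ m)                  ≈⟨ *-cong e²≈2ξ (e^[m+m]≈2^m·ξ^m m) ⟩
    (ι (+ 2) * ξ) * (ι ((+ 2) F.^ m) * ξ ^ m)
      ≈⟨ solve 4 (λ T ξ P X → (T :* ξ) :* (P :* X) := (T :* P) :* (ξ :* X)) refl (ι (+ 2)) ξ (ι ((+ 2) F.^ m)) (ξ ^ m) ⟩
    (ι (+ 2) * ι ((+ 2) F.^ m)) * ξ ^ suc m    ≈⟨ *-cong (ι-* (+ 2) ((+ 2) F.^ m)) refl ⟨
    ι ((+ 2) F.^ suc m) * ξ ^ suc m            ∎

  ξ^[1+n+n]≈ξη^n : ∀ n → ξ ^ suc (n ℕ.+ n) ≈ ξ * η ^ n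
  ξ^[1+n+n]≈ξη^n n = *-cong refl (begin
    ξ ^ (n ℕ.+ n)     ≈⟨ ^-homo-* ξ n n ⟩
    ξ ^ n * ξ ^ n     ≈⟨ ^-distrib-* ξ ξ n ⟨
    (ξ * ξ) ^ n       ≈⟨ ^-congˡ n ξ²≈η ⟩
    η ^ n             ∎)

  c₃[e^[N+N]]≈2^N·wₙ : ∀ n → let N = suc (n ℕ.+ n) in c₃ (e ^ (N ℕ.+ N)) F.≈ (+ 2) F.^ N ℤ.* wℤ n t
  c₃[e^[N+N]]≈2^N·wₙ n = F.≈-trans (c₃-cong (trans (e^[m+m]≈2^m·ξ^m N) (*-cong refl (ξ^[1+n+n]≈ξη^n n))))
                           (F.≈-trans (c₃-ι* _ _) (F.*-congˡ {(+ 2) F.^ N} (c₃[ξη^n]≈wₙ n)))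
    where
    N : ℕ
    N = suc (n ℕ.+ n)

module HalfAngleFrobenius (p h : ℕ) (p-prime : Prime p) (p≡1+2h : p ≡ suc (h ℕ.+ h)) (z : ℤ) where
  open HalfAngle p z public
  private module ℤ/p = PrimeField p p-prime
  open import Algebra.Solver.Ring.NaturalCoefficients.Default commutativeSemiring
  open import Relation.Binary.Reasoning.Setoid setoid
  open import Algebra.Properties.CommutativeSemiring.Exp commutativeSemiring using (^-distrib-*)
  open Frobenius commutativeSemiring p-prime using (frobenius)

  A B : ℤ
  A = a F.^ h
  B = b F.^ h

  x²≈y⇒x^p≈y^h·x : ∀ {x y} → x * x ≈ y → x ^ p ≈ y ^ h * x
  x²≈y⇒x^p≈y^h·x {x} {y} x²≈y = begin
    x ^ p                 ≡⟨ ≡.cong (x ^_) p≡1+2h ⟩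
    x * x ^ (h ℕ.+ h)     ≈⟨ *-cong refl (^-homo-* x h h) ⟩
    x * (x ^ h * x ^ h)   ≈⟨ *-cong refl (^-distrib-* x x h) ⟨
    x * (x * x) ^ h       ≈⟨ *-cong refl (^-congˡ h x²≈y) ⟩
    x * y ^ h             ≈⟨ *-comm x _ ⟩
    y ^ h * x             ∎

  ι-fermat : ∀ u → ι u ^ p ≈ ι u
  ι-fermat u = trans (sym (ι-^ u p)) (ι-cong (ℤ/p.fermat u))

  odd^p : ∀ u v → odd u v ^ p ≈ odd (u ℤ.* A) (v ℤ.* B)
  odd^p u v = begin
    (ι u * α + ι v * β) ^ p            ≈⟨ frobenius (characteristic {p} ℤ/p.characteristic) _ _ ⟩
    (ι u * α) ^ p + (ι v * β) ^ p      ≈⟨ +-cong (^-distrib-* (ι u) α p) (^-distrib-* (ι v) β p) ⟩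
    ι u ^ p * α ^ p + ι v ^ p * β ^ p
      ≈⟨ +-cong (*-cong (ι-fermat u) (x²≈y⇒x^p≈y^h·x α²≈ιa)) (*-cong (ι-fermat v) (x²≈y⇒x^p≈y^h·x β²≈ιb)) ⟩
    ι u * (ι a ^ h * α) + ι v * (ι b ^ h * β)
      ≈⟨ +-cong (*-cong refl (*-cong (ι-^ a h) refl)) (*-cong refl (*-cong (ι-^ b h) refl)) ⟨
    ι u * (ι A * α) + ι v * (ι B * β)  ≈⟨ +-cong (trans (*-cong (ι-* u A) refl) (*-assoc _ _ _)) (trans (*-cong (ι-* v B) refl) (*-assoc _ _ _)) ⟨
    odd (u ℤ.* A) (v ℤ.* B)            ∎

  e′e≈2 : e′ * e ≈ ι (+ 2)
  e′e≈2 = begin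
    e′ * e                    ≈⟨ odd*odd 1ℤ (ℤ.- 1ℤ) 1ℤ 1ℤ ⟩
    even _ _                  ≈⟨ even-cong (F.≡⇒≈ (re z)) (F.≡⇒≈ ≡.refl) ⟩
    ι (+ 2) + ι 0ℤ * γ        ≈⟨ +-cong refl (zeroˡ γ) ⟩
    ι (+ 2) + 0#              ≈⟨ +-identityʳ _ ⟩
    ι (+ 2)                   ∎
    where
    re : ∀ z → 1ℤ ℤ.* 1ℤ ℤ.* (1ℤ ℤ.+ z) ℤ.+ ℤ.- 1ℤ ℤ.* 1ℤ ℤ.* (z ℤ.- 1ℤ) ≡ + 2
    re = solve-∀

  e³≈odd : e ^ 3 ≈ odd (ℤ.- (+ 2) ℤ.* (1ℤ ℤ.- + 2 ℤ.* z)) (+ 2 ℤ.* (1ℤ ℤ.+ + 2 ℤ.* z))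
  e³≈odd = begin
    e * (e * (e * 1#))        ≈⟨ solve 1 (λ e → e :* (e :* (e :* con 1)) := (e :* e) :* e) refl e ⟩
    (e * e) * e               ≈⟨ *-cong (odd*odd 1ℤ 1ℤ 1ℤ 1ℤ) refl ⟩
    even _ _ * odd 1ℤ 1ℤ      ≈⟨ even*odd _ _ 1ℤ 1ℤ ⟩
    odd _ _                   ≈⟨ odd-cong (F.≡⇒≈ (re z)) (F.≡⇒≈ (im z)) ⟩
    odd (ℤ.- (+ 2) ℤ.* (1ℤ ℤ.- + 2 ℤ.* z)) (+ 2 ℤ.* (1ℤ ℤ.+ + 2 ℤ.* z)) ∎
    where
    re : ∀ z → (1ℤ ℤ.* 1ℤ ℤ.* (1ℤ ℤ.+ z) ℤ.+ 1ℤ ℤ.* 1ℤ ℤ.* (z ℤ.- 1ℤ)) ℤ.* 1ℤ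
                 ℤ.+ (1ℤ ℤ.* 1ℤ ℤ.+ 1ℤ ℤ.* 1ℤ) ℤ.* 1ℤ ℤ.* (z ℤ.- 1ℤ)
               ≡ ℤ.- (+ 2) ℤ.* (1ℤ ℤ.- + 2 ℤ.* z)
    re = solve-∀
    im : ∀ z → (1ℤ ℤ.* 1ℤ ℤ.* (1ℤ ℤ.+ z) ℤ.+ 1ℤ ℤ.* 1ℤ ℤ.* (z ℤ.- 1ℤ)) ℤ.* 1ℤ
                 ℤ.+ (1ℤ ℤ.* 1ℤ ℤ.+ 1ℤ ℤ.* 1ℤ) ℤ.* 1ℤ ℤ.* (1ℤ ℤ.+ z)
               ≡ + 2 ℤ.* (1ℤ ℤ.+ + 2 ℤ.* z)
    im = solve-∀

  e^[mp]≈odd : ∀ {m u v} → e ^ m ≈ odd u v → e ^ (m ℕ.* p) ≈ odd (u ℤ.* A) (v ℤ.* B)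
  e^[mp]≈odd {m} {u} {v} e^m≈odd = begin
    e ^ (m ℕ.* p)    ≈⟨ ^-assocʳ e m p ⟨
    (e ^ m) ^ p      ≈⟨ ^-congˡ p e^m≈odd ⟩
    odd u v ^ p      ≈⟨ odd^p u v ⟩
    odd (u ℤ.* A) (v ℤ.* B) ∎

  c₃[e^[1+mp]] : ∀ {m u v} → e ^ m ≈ odd u v → c₃ (e ^ suc (m ℕ.* p)) F.≈ u ℤ.* A ℤ.+ v ℤ.* B
  c₃[e^[1+mp]] {m} {u} {v} e^m≈odd = F.≈-trans (c₃-cong (begin
    e * e ^ (m ℕ.* p)              ≈⟨ *-cong refl (e^[mp]≈odd {m} e^m≈odd) ⟩
    e * odd (u ℤ.* A) (v ℤ.* B)    ≈⟨ odd*odd 1ℤ 1ℤ (u ℤ.* A) (v ℤ.* B) ⟩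
    even _ _                       ∎)) (F.≈-trans (c₃-even _ _) (F.≡⇒≈ (tidy (u ℤ.* A) (v ℤ.* B))))
    where
    tidy : ∀ U V → 1ℤ ℤ.* V ℤ.+ 1ℤ ℤ.* U ≡ U ℤ.+ V
    tidy = solve-∀

  2c₃[e^[mp-1]] : ∀ {m u v n} → e ^ m ≈ odd u v → suc n ≡ m ℕ.* p → + 2 ℤ.* c₃ (e ^ n) F.≈ v ℤ.* B ℤ.- u ℤ.* A
  2c₃[e^[mp-1]] {m} {u} {v} {n} e^m≈odd 1+n≡mp = F.≈-trans (F.≈-sym (c₃-ι* (+ 2) (e ^ n))) (F.≈-trans (c₃-cong (begin
    ι (+ 2) * e ^ n                ≈⟨ *-cong e′e≈2 refl ⟨
    (e′ * e) * e ^ n               ≈⟨ *-assoc e′ e _ ⟩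
    e′ * e ^ suc n                 ≡⟨ ≡.cong (λ k → e′ * e ^ k) 1+n≡mp ⟩
    e′ * e ^ (m ℕ.* p)             ≈⟨ *-cong refl (e^[mp]≈odd {m} e^m≈odd) ⟩
    e′ * odd (u ℤ.* A) (v ℤ.* B)   ≈⟨ odd*odd 1ℤ (ℤ.- 1ℤ) (u ℤ.* A) (v ℤ.* B) ⟩
    even _ _                       ∎)) (F.≈-trans (c₃-even _ _) (F.≡⇒≈ (tidy (u ℤ.* A) (v ℤ.* B)))))
    where
    tidy : ∀ U V → 1ℤ ℤ.* V ℤ.+ ℤ.- 1ℤ ℤ.* U ≡ V ℤ.- U
    tidy = solve-∀

-- In the notation of the theorem, with x ≡ z: L₁ = ((1-x)/p), L₂ = ((1+x)/p), ((-2)/p) = S·G.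
module SymbolValues (p h : ℕ) (p-prime : Prime p) (p≡1+2h : p ≡ suc (h ℕ.+ h)) (z : ℤ) where
  open EulerCriterion p h p-prime p≡1+2h using (positive≉0; 2<p)
  open PrimeField p p-prime
  open import Relation.Binary.Reasoning.Setoid ≈-setoid
  open import Algebra.Properties.CommutativeSemiring.Exp commutativeSemiring using (^-distrib-*)

  G S L₁ L₂ : ℤ
  G  = (+ 2) ^ h
  S  = (ℤ.- 1ℤ) ^ h
  L₁ = (1ℤ ℤ.- z) ^ h
  L₂ = (1ℤ ℤ.+ z) ^ h

  X₁ X₂ : ℤ
  X₁ = L₁ ℤ.+ L₂
  X₂ = L₁ ℤ.* (1ℤ ℤ.+ + 2 ℤ.* z) ℤ.+ L₂ ℤ.* (1ℤ ℤ.- + 2 ℤ.* z)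

  p∸1≡h+h : p ℕ.∸ 1 ≡ h ℕ.+ h
  p∸1≡h+h = ≡.cong (ℕ._∸ 1) p≡1+2h

  2≉0 : ¬ + 2 ≈ 0ℤ
  2≉0 = positive≉0 (s≤s z≤n) 2<p

  G²≈1 : G ℤ.* G ≈ 1ℤ
  G²≈1 = ≈-trans (≈-sym (^-homo-* (+ 2) h h)) (≈-trans (^-congʳ (+ 2) (≡.sym p∸1≡h+h)) (fermat-unit 2≉0))

  2^[3h]≈G : (+ 2) ^ (h ℕ.+ (h ℕ.+ h)) ≈ G
  2^[3h]≈G = begin
    (+ 2) ^ (h ℕ.+ (h ℕ.+ h))   ≈⟨ ^-homo-* (+ 2) h (h ℕ.+ h) ⟩
    G ℤ.* (+ 2) ^ (h ℕ.+ h)     ≈⟨ *-congˡ {G} (≈-trans (^-homo-* (+ 2) h h) G²≈1) ⟩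
    G ℤ.* 1ℤ                    ≡⟨ ℤP.*-identityʳ G ⟩
    G                           ∎

  [-2]^h≈SG : (ℤ.- (+ 2)) ^ h ≈ S ℤ.* G
  [-2]^h≈SG = ^-distrib-* (ℤ.- 1ℤ) (+ 2) h

  [z-1]^h≈SL₁ : (z ℤ.- 1ℤ) ^ h ≈ S ℤ.* L₁
  [z-1]^h≈SL₁ = ≈-trans (^-congˡ h (≡⇒≈ (flip z))) (^-distrib-* (ℤ.- 1ℤ) (1ℤ ℤ.- z) h)
    where
    flip : ∀ z → z ℤ.- 1ℤ ≡ ℤ.- 1ℤ ℤ.* (1ℤ ℤ.- z)
    flip = solve-∀

  2GW≈SX⇒2W≈[-2]^hX : ∀ {W X} → + 2 ℤ.* G ℤ.* W ≈ S ℤ.* X → + 2 ℤ.* W ≈ (ℤ.- (+ 2)) ^ h ℤ.* X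
  2GW≈SX⇒2W≈[-2]^hX {W} {X} 2GW≈SX = begin
    + 2 ℤ.* W                        ≡⟨ ℤP.*-identityˡ _ ⟨
    1ℤ ℤ.* (+ 2 ℤ.* W)               ≈⟨ *-congʳ {+ 2 ℤ.* W} G²≈1 ⟨
    G ℤ.* G ℤ.* (+ 2 ℤ.* W)          ≡⟨ shuffle G (+ 2) W ⟩
    G ℤ.* (+ 2 ℤ.* G ℤ.* W)          ≈⟨ *-congˡ {G} 2GW≈SX ⟩
    G ℤ.* (S ℤ.* X)                  ≡⟨ shuffle′ G S X ⟩
    S ℤ.* G ℤ.* X                    ≈⟨ *-congʳ {X} [-2]^h≈SG ⟨
    (ℤ.- (+ 2)) ^ h ℤ.* X            ∎
    where
    shuffle : ∀ g d w → g ℤ.* g ℤ.* (d ℤ.* w) ≡ g ℤ.* (d ℤ.* g ℤ.* w)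
    shuffle = solve-∀
    shuffle′ : ∀ g s x → g ℤ.* (s ℤ.* x) ≡ s ℤ.* g ℤ.* x
    shuffle′ = solve-∀

-- q ↦ r: the rational q lies in D_p and reduces to the residue of r modulo p.
module ModularReduction (p : ℕ) (p-prime : Prime p) where
  open PrimeField p p-prime
  open import Relation.Binary.Reasoning.Setoid ≈-setoid

  infix 4 _↦ᵘ_ _↦_

  record _↦ᵘ_ (u : ℚᵘ) (r : ℤ) : Set where
    constructor reduces
    field
      p∤↧ : ¬ p ℕ∣.∣ ℚᵘ.↧ₙ u
      ↥≈ : ℚᵘ.↥ u ≈ r ℤ.* ℚᵘ.↧ u

  record _↦_ (q : ℚ) (r : ℤ) : Set where
    constructor reduces
    field
      p∤↧ : ¬ p ℕ∣.∣ ↧ₙ q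
      ↥≈ : ↥ q ≈ r ℤ.* ↧ q

  ↦⇒↦ᵘ : ∀ {q r} → q ↦ r → toℚᵘ q ↦ᵘ r
  ↦⇒↦ᵘ {mkℚ _ _ _} (reduces p∤↧ ↥≈) = reduces p∤↧ ↥≈

  private
    p∤* : ∀ {m n} → ¬ p ℕ∣.∣ m → ¬ p ℕ∣.∣ n → ¬ p ℕ∣.∣ m ℕ.* n
    p∤* p∤m p∤n p∣mn with euclidsLemma _ _ p-prime p∣mn
    ... | inj₁ p∣m = p∤m p∣m
    ... | inj₂ p∣n = p∤n p∣n

  ↦ᵘ-+ : ∀ {u v r s} → u ↦ᵘ r → v ↦ᵘ s → u ℚᵘ.+ v ↦ᵘ r ℤ.+ s
  ↦ᵘ-+ {mkℚᵘ m d} {mkℚᵘ n e} {r} {s} (reduces p∤d m≈rd) (reduces p∤e n≈se) = reduces (p∤* p∤d p∤e) (begin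
    m ℤ.* + suc e ℤ.+ n ℤ.* + suc d                            ≈⟨ +-cong (*-congʳ {+ suc e} m≈rd) (*-congʳ {+ suc d} n≈se) ⟩
    r ℤ.* + suc d ℤ.* + suc e ℤ.+ s ℤ.* + suc e ℤ.* + suc d    ≡⟨ collect r s (+ suc d) (+ suc e) ⟩
    (r ℤ.+ s) ℤ.* (+ suc d ℤ.* + suc e)                        ≡⟨ ≡.cong ((r ℤ.+ s) ℤ.*_) (ℤP.pos-* (suc d) (suc e)) ⟨
    (r ℤ.+ s) ℤ.* + (suc d ℕ.* suc e)                          ∎)
    where
    collect : ∀ r s D E → r ℤ.* D ℤ.* E ℤ.+ s ℤ.* E ℤ.* D ≡ (r ℤ.+ s) ℤ.* (D ℤ.* E)
    collect = solve-∀

  ↦ᵘ-* : ∀ {u v r s} → u ↦ᵘ r → v ↦ᵘ s → u ℚᵘ.* v ↦ᵘ r ℤ.* s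
  ↦ᵘ-* {mkℚᵘ m d} {mkℚᵘ n e} {r} {s} (reduces p∤d m≈rd) (reduces p∤e n≈se) = reduces (p∤* p∤d p∤e) (begin
    m ℤ.* n                                    ≈⟨ *-cong m≈rd n≈se ⟩
    r ℤ.* + suc d ℤ.* (s ℤ.* + suc e)          ≡⟨ collect r s (+ suc d) (+ suc e) ⟩
    (r ℤ.* s) ℤ.* (+ suc d ℤ.* + suc e)        ≡⟨ ≡.cong ((r ℤ.* s) ℤ.*_) (ℤP.pos-* (suc d) (suc e)) ⟨
    (r ℤ.* s) ℤ.* + (suc d ℕ.* suc e)          ∎)
    where
    collect : ∀ r s D E → r ℤ.* D ℤ.* (s ℤ.* E) ≡ (r ℤ.* s) ℤ.* (D ℤ.* E)
    collect = solve-∀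

  ↦ᵘ-neg : ∀ {u r} → u ↦ᵘ r → ℚᵘ.- u ↦ᵘ ℤ.- r
  ↦ᵘ-neg {mkℚᵘ m d} {r} (reduces p∤d m≈rd) = reduces p∤d (≈-trans (-‿cong m≈rd) (≡⇒≈ (ℤP.neg-distribˡ-* r (+ suc d))))

  -- The reduced denominator divides every other denominator, so reduction is well defined on ℚ.
  ↦-resp-≃ : ∀ {q u r} → toℚᵘ q ℚᵘ.≃ u → u ↦ᵘ r → q ↦ r
  ↦-resp-≃ {mkℚ n d coprime} {mkℚᵘ m e} {r} (*≡* n[1+e]≡m[1+d]) (reduces p∤1+e m≈r[1+e]) =
    reduces p∤1+d (*-cancelˡ 1+e≉0 (begin
      + suc e ℤ.* n                    ≡⟨ ℤP.*-comm (+ suc e) n ⟩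
      n ℤ.* + suc e                    ≡⟨ n[1+e]≡m[1+d] ⟩
      m ℤ.* + suc d                    ≈⟨ *-congʳ {+ suc d} m≈r[1+e] ⟩
      r ℤ.* + suc e ℤ.* + suc d        ≡⟨ shuffle r (+ suc e) (+ suc d) ⟩
      + suc e ℤ.* (r ℤ.* + suc d)      ∎))
    where
    shuffle : ∀ r E D → r ℤ.* E ℤ.* D ≡ E ℤ.* (r ℤ.* D)
    shuffle = solve-∀
    1+d∣1+e : suc d ℕ∣.∣ suc e
    1+d∣1+e = Coprime.coprime-divisor (Coprime.sym (Coprime.recompute coprime))
      (divides ℤ.∣ m ∣ (≡.trans (≡.sym (ℤP.abs-* n (+ suc e))) (≡.trans (≡.cong ℤ.∣_∣ n[1+e]≡m[1+d]) (ℤP.abs-* m (+ suc d)))))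
    p∤1+d : ¬ p ℕ∣.∣ suc d
    p∤1+d p∣1+d = p∤1+e (ℕ∣.∣-trans p∣1+d 1+d∣1+e)
    1+e≉0 : ¬ + suc e ≈ 0ℤ
    1+e≉0 1+e≈0 = p∤1+e (≈0⇒∣ 1+e≈0)

  ↦-+ : ∀ {q q′ r r′} → q ↦ r → q′ ↦ r′ → q ℚ.+ q′ ↦ r ℤ.+ r′
  ↦-+ {q} {q′} q↦r q′↦r′ = ↦-resp-≃ (ℚP.toℚᵘ-homo-+ q q′) (↦ᵘ-+ (↦⇒↦ᵘ q↦r) (↦⇒↦ᵘ q′↦r′))

  ↦-* : ∀ {q q′ r r′} → q ↦ r → q′ ↦ r′ → q ℚ.* q′ ↦ r ℤ.* r′
  ↦-* {q} {q′} q↦r q′↦r′ = ↦-resp-≃ (ℚP.toℚᵘ-homo-* q q′) (↦ᵘ-* (↦⇒↦ᵘ q↦r) (↦⇒↦ᵘ q′↦r′))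

  ↦-neg : ∀ {q r} → q ↦ r → ℚ.- q ↦ ℤ.- r
  ↦-neg {q} q↦r = ↦-resp-≃ (ℚP.toℚᵘ-homo‿- q) (↦ᵘ-neg (↦⇒↦ᵘ q↦r))

  ↦-- : ∀ {q q′ r r′} → q ↦ r → q′ ↦ r′ → q ℚ.- q′ ↦ r ℤ.- r′
  ↦-- q↦r q′↦r′ = ↦-+ q↦r (↦-neg q′↦r′)

  ↦-≈ : ∀ {q r r′} → q ↦ r → r ≈ r′ → q ↦ r′
  ↦-≈ {q} (reduces p∤↧ ↥≈) r≈r′ = reduces p∤↧ (≈-trans ↥≈ (*-congʳ {↧ q} r≈r′))

  ↦-integer : ∀ r → r ℚ./ 1 ↦ r
  ↦-integer r = ↦-resp-≃ (ℚP.toℚᵘ-fromℚᵘ (mkℚᵘ r 0)) (reduces p∤1 (≡⇒≈ (≡.sym (ℤP.*-identityʳ r))))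
    where
    p∤1 : ¬ p ℕ∣.∣ 1
    p∤1 p∣1 = ℕP.<⇒≢ 1<p (≡.sym (ℕ∣.∣1⇒≡1 p∣1))

  ↦-1 : 1ℚ ↦ 1ℤ
  ↦-1 = ↦-integer 1ℤ

  ↦-exists : ∀ {x} → InD p x → Σ ℤ (x ↦_)
  ↦-exists {x} p∤↧x = ↥ x ℤ.* (↧ x) ⁻¹ , reduces p∤↧x (begin
    ↥ x                                ≡⟨ ℤP.*-identityʳ (↥ x) ⟨
    ↥ x ℤ.* 1ℤ                         ≈⟨ *-congˡ {↥ x} (*-inverseʳ ↧x≉0) ⟨
    ↥ x ℤ.* (↧ x ℤ.* (↧ x) ⁻¹)         ≡⟨ shuffle (↥ x) (↧ x) ((↧ x) ⁻¹) ⟩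
    ↥ x ℤ.* (↧ x) ⁻¹ ℤ.* ↧ x           ∎)
    where
    ↧x≉0 : ¬ ↧ x ≈ 0ℤ
    ↧x≉0 ↧x≈0 = p∤↧x (≈0⇒∣ ↧x≈0)
    shuffle : ∀ n d i → n ℤ.* (d ℤ.* i) ≡ n ℤ.* i ℤ.* d
    shuffle = solve-∀

  ↦⇒≡[mod] : ∀ {a b r s} → a ↦ r → b ↦ s → r ≈ s → a ≡ b [mod p ]
  ↦⇒≡[mod] {a} {b} {r} {s} a↦r b↦s r≈s = ≈0⇒∣ (begin
    ↥ (a ℚ.- b)                        ≈⟨ ↥≈ ⟩
    (r ℤ.- s) ℤ.* ↧ (a ℚ.- b)          ≈⟨ *-congʳ {↧ (a ℚ.- b)} (x≈y⇒x-y≈0 r≈s) ⟩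
    0ℤ ℤ.* ↧ (a ℚ.- b)                 ≡⟨ ℤP.*-zeroˡ (↧ (a ℚ.- b)) ⟩
    0ℤ                                 ∎) , p∤↧
    where open _↦_ (↦-- a↦r b↦s)

  ↦-w : ∀ n {q r} → q ↦ r → w n q ↦ wℤ n r
  ↦-w zero          q↦r = ↦-1
  ↦-w (suc zero)    q↦r = ↦-+ ↦-1 (↦-* (↦-integer (+ 2)) q↦r)
  ↦-w (suc (suc n)) q↦r = ↦-- (↦-* (↦-* (↦-integer (+ 2)) q↦r) (↦-w (suc n) q↦r)) (↦-w n q↦r)

module LegendreReduction (p h : ℕ) (p-prime : Prime p) (p≡1+2h : p ≡ suc (h ℕ.+ h)) where
  open PrimeField p p-prime
  open ModularReduction p p-prime
  open EulerCriterion p h p-prime p≡1+2h using (euler; 2<p)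
  open import Relation.Binary.Reasoning.Setoid ≈-setoid
  open import Algebra.Properties.CommutativeSemiring.Exp commutativeSemiring using (^-distrib-*)

  ↦-½ : ½ ↦ + suc h
  ↦-½ = reduces p∤2 (≈-sym (x-y≈0⇒x≈y (begin
    + suc h ℤ.* + 2 ℤ.- 1ℤ     ≡⟨ double-minus-one h ⟩
    1ℤ ℤ.* + suc (h ℕ.+ h)     ≡⟨ cong (λ n → 1ℤ ℤ.* + n) (≡.sym p≡1+2h) ⟩
    1ℤ ℤ.* + p                 ≈⟨ multiple≈0 1ℤ ⟩
    0ℤ                         ∎)))
    where
    p∤2 : ¬ p ℕ∣.∣ 2
    p∤2 p∣2 = ℕP.<⇒≱ 2<p (ℕ∣.∣⇒≤ p∣2)
    double-minus-one : ∀ h → + suc h ℤ.* + 2 ℤ.- 1ℤ ≡ 1ℤ ℤ.* + suc (h ℕ.+ h)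
    double-minus-one h = identity (+ h)
      where
      identity : ∀ H → (1ℤ ℤ.+ H) ℤ.* + 2 ℤ.- 1ℤ ≡ 1ℤ ℤ.* (1ℤ ℤ.+ (H ℤ.+ H))
      identity = solve-∀

  ↦-legendre : ∀ {c r} → c ↦ r → legendre c p ↦ r ^ h
  ↦-legendre {c} {r} (reduces p∤↧c ↥c≈r↧c) = ↦-≈ (↦-integer (legendreℤ p (↥ c ℤ.* ↧ c))) (begin
    legendreℤ p (↥ c ℤ.* ↧ c)          ≈⟨ euler (↥ c ℤ.* ↧ c) ⟩
    (↥ c ℤ.* ↧ c) ^ h                  ≈⟨ ^-congˡ h (≈-trans (*-congʳ {↧ c} ↥c≈r↧c) (≡⇒≈ (ℤP.*-assoc r (↧ c) (↧ c)))) ⟩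
    (r ℤ.* (↧ c ℤ.* ↧ c)) ^ h          ≈⟨ ^-distrib-* r _ h ⟩
    r ^ h ℤ.* (↧ c ℤ.* ↧ c) ^ h        ≈⟨ *-congˡ {r ^ h} d²ʰ≈1 ⟩
    r ^ h ℤ.* 1ℤ                       ≡⟨ ℤP.*-identityʳ (r ^ h) ⟩
    r ^ h                              ∎)
    where
    d²ʰ≈1 : (↧ c ℤ.* ↧ c) ^ h ≈ 1ℤ
    d²ʰ≈1 = ≈-trans (^-distrib-* (↧ c) (↧ c) h) (≈-trans (≈-sym (^-homo-* (↧ c) h h))
              (≈-trans (^-congʳ (↧ c) (≡.sym (≡.cong (ℕ._∸ 1) p≡1+2h))) (fermat-unit (λ ↧c≈0 → p∤↧c (≈0⇒∣ ↧c≈0)))))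

  halve : ∀ {a y} → + 2 ℤ.* a ≈ y → a ≈ + suc h ℤ.* y
  halve {a} {y} 2a≈y = begin
    a                              ≡⟨ ℤP.*-identityˡ a ⟨
    1ℤ ℤ.* a                       ≈⟨ *-congʳ {a} (_↦_.↥≈ ↦-½) ⟩
    + suc h ℤ.* + 2 ℤ.* a          ≡⟨ ℤP.*-assoc (+ suc h) (+ 2) a ⟩
    + suc h ℤ.* (+ 2 ℤ.* a)        ≈⟨ *-congˡ {+ suc h} 2a≈y ⟩
    + suc h ℤ.* y                  ∎

module RationalForm (p h : ℕ) (p-prime : Prime p) (p≡1+2h : p ≡ suc (h ℕ.+ h)) (x : ℚ) (x∈D : InD p x) where
  open PrimeField p p-prime
  open ModularReduction p p-prime
  open LegendreReduction p h p-prime p≡1+2h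

  z : ℤ
  z = proj₁ (↦-exists {x} x∈D)

  x↦z : x ↦ z
  x↦z = proj₂ (↦-exists {x} x∈D)

  open SymbolValues p h p-prime p≡1+2h z using (X₁; X₂)

  t : ℚ
  t = (+ 2 ℚ./ 1) ℚ.* x ℚ.* x ℚ.- 1ℚ

  t↦ : t ↦ + 2 ℤ.* z ℤ.* z ℤ.- 1ℤ
  t↦ = ↦-- (↦-* (↦-* (↦-integer (+ 2)) x↦z) x↦z) ↦-1

  ↦-[-2/p] : legendre (ℚ.- (+ 2 ℚ./ 1)) p ↦ (ℤ.- (+ 2)) ^ h
  ↦-[-2/p] = ↦-legendre (↦-neg (↦-integer (+ 2)))

  ↦-[1-x/p] : legendre (1ℚ ℚ.- x) p ↦ (1ℤ ℤ.- z) ^ h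
  ↦-[1-x/p] = ↦-legendre (↦-- ↦-1 x↦z)

  ↦-[1+x/p] : legendre (1ℚ ℚ.+ x) p ↦ (1ℤ ℤ.+ z) ^ h
  ↦-[1+x/p] = ↦-legendre (↦-+ ↦-1 x↦z)

  rhs₁ rhs₂ : ℚ
  rhs₁ = ½ ℚ.* legendre (ℚ.- (+ 2 ℚ./ 1)) p ℚ.* (legendre (1ℚ ℚ.- x) p ℚ.+ legendre (1ℚ ℚ.+ x) p)
  rhs₂ = ½ ℚ.* legendre (ℚ.- (+ 2 ℚ./ 1)) p ℚ.* (legendre (1ℚ ℚ.- x) p ℚ.* (1ℚ ℚ.+ (+ 2 ℚ./ 1) ℚ.* x)
                                                  ℚ.+ legendre (1ℚ ℚ.+ x) p ℚ.* (1ℚ ℚ.- (+ 2 ℚ./ 1) ℚ.* x))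

  congruence₁ : ∀ {n} → + 2 ℤ.* wℤ n (+ 2 ℤ.* z ℤ.* z ℤ.- 1ℤ) ≈ (ℤ.- (+ 2)) ^ h ℤ.* X₁ → w n t ≡ rhs₁ [mod p ]
  congruence₁ {n} 2w≈ = ↦⇒≡[mod] (↦-w n t↦) (↦-* (↦-* ↦-½ ↦-[-2/p]) (↦-+ ↦-[1-x/p] ↦-[1+x/p]))
    (≈-trans (halve 2w≈) (≡⇒≈ (≡.sym (ℤP.*-assoc (+ suc h) ((ℤ.- (+ 2)) ^ h) X₁))))

  congruence₂ : ∀ {n} → + 2 ℤ.* wℤ n (+ 2 ℤ.* z ℤ.* z ℤ.- 1ℤ) ≈ (ℤ.- (+ 2)) ^ h ℤ.* X₂ → w n t ≡ rhs₂ [mod p ]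
  congruence₂ {n} 2w≈ = ↦⇒≡[mod] (↦-w n t↦)
    (↦-* (↦-* ↦-½ ↦-[-2/p]) (↦-+ (↦-* ↦-[1-x/p] (↦-+ ↦-1 2x↦)) (↦-* ↦-[1+x/p] (↦-- ↦-1 2x↦))))
    (≈-trans (halve 2w≈) (≡⇒≈ (≡.sym (ℤP.*-assoc (+ suc h) ((ℤ.- (+ 2)) ^ h) X₂))))
    where
    2x↦ : (+ 2 ℚ./ 1) ℚ.* x ↦ + 2 ℤ.* z
    2x↦ = ↦-* (↦-integer (+ 2)) x↦z

[r+m*4]/4≡m : ∀ r m → r < 4 → (r ℕ.+ m ℕ.* 4) ℕ./ 4 ≡ m
[r+m*4]/4≡m r m r<4 = ≡.trans (ℕ÷.+-distrib-/-∣ʳ r (ℕ∣.divides m ≡.refl)) (≡.cong₂ ℕ._+_ (ℕ÷.m<n⇒m/n≡0 r<4) (ℕ÷.m*n/n≡m m 4))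

-- Here 2⌊p/4⌋ + 1 = (p + 1)/2 and 2⌊3p/4⌋ + 1 = (3p - 1)/2.
module OneModFour (p k : ℕ) (p-prime : Prime p) (p≡1+4k : p ≡ suc ((k ℕ.+ k) ℕ.+ (k ℕ.+ k))) (x : ℚ) (x∈D : InD p x) where
  open import Data.Product using (_×_)
  h : ℕ
  h = k ℕ.+ k
  open RationalForm p h p-prime p≡1+4k x x∈D
  open SymbolValues p h p-prime p≡1+4k z
  open PrimeField p p-prime
  private module H = HalfAngleFrobenius p h p-prime p≡1+4k z
  open import Relation.Binary.Reasoning.Setoid ≈-setoid

  S≈1 : S ≈ 1ℤ
  S≈1 = [-1]^[k+k]≈1 k

  B≈L₁ : H.B ≈ L₁
  B≈L₁ = ≈-trans [z-1]^h≈SL₁ (≈-trans (*-congʳ {L₁} S≈1) (≡⇒≈ (ℤP.*-identityˡ L₁)))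

  2w[⌊p/4⌋]≈ : + 2 ℤ.* wℤ k H.t ≈ (ℤ.- (+ 2)) ^ h ℤ.* X₁
  2w[⌊p/4⌋]≈ = 2GW≈SX⇒2W≈[-2]^hX (begin
    + 2 ℤ.* G ℤ.* wℤ k H.t                   ≈⟨ H.c₃[e^[N+N]]≈2^N·wₙ k ⟨
    H.c₃ (H.e H.^ (suc h ℕ.+ suc h))         ≡⟨ ≡.cong (λ n → H.c₃ (H.e H.^ n)) N+N≡1+p ⟩
    H.c₃ (H.e H.^ suc (1 ℕ.* p))             ≈⟨ H.c₃[e^[1+mp]] {1} (H.*-identityʳ H.e) ⟩
    1ℤ ℤ.* L₂ ℤ.+ 1ℤ ℤ.* H.B                 ≈⟨ +-congˡ {1ℤ ℤ.* L₂} (*-congˡ {1ℤ} B≈L₁) ⟩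
    1ℤ ℤ.* L₂ ℤ.+ 1ℤ ℤ.* L₁                  ≡⟨ tidy L₁ L₂ ⟩
    1ℤ ℤ.* X₁                                ≈⟨ *-congʳ {X₁} S≈1 ⟨
    S ℤ.* X₁                                 ∎)
    where
    N+N≡1+p : suc h ℕ.+ suc h ≡ suc (1 ℕ.* p)
    N+N≡1+p = ≡.trans (count h) (≡.cong (λ q → suc (1 ℕ.* q)) (≡.sym p≡1+4k))
      where
      count : ∀ h → suc h ℕ.+ suc h ≡ suc (1 ℕ.* suc (h ℕ.+ h))
      count = ℕ-Solver.solve-∀
    tidy : ∀ l₁ l₂ → 1ℤ ℤ.* l₂ ℤ.+ 1ℤ ℤ.* l₁ ≡ 1ℤ ℤ.* (l₁ ℤ.+ l₂)
    tidy = solve-∀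

  2w[⌊3p/4⌋]≈ : + 2 ℤ.* wℤ (k ℕ.+ (k ℕ.+ k)) H.t ≈ (ℤ.- (+ 2)) ^ h ℤ.* X₂
  2w[⌊3p/4⌋]≈ = 2GW≈SX⇒2W≈[-2]^hX (*-cancelˡ 2≉0 (begin
    + 2 ℤ.* (+ 2 ℤ.* G ℤ.* W)                          ≈⟨ *-congˡ {+ 2} (*-congʳ {W} (*-congˡ {+ 2} 2^[n+n]≈G)) ⟨
    + 2 ℤ.* (+ 2 ℤ.* (+ 2) ^ (n ℕ.+ n) ℤ.* W)          ≈⟨ *-congˡ {+ 2} (H.c₃[e^[N+N]]≈2^N·wₙ n) ⟨
    + 2 ℤ.* H.c₃ (H.e H.^ (N ℕ.+ N))                   ≈⟨ H.2c₃[e^[mp-1]] {3} H.e³≈odd 1+N+N≡3p ⟩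
    v₃ ℤ.* H.B ℤ.- u₃ ℤ.* L₂                           ≈⟨ +-congʳ {ℤ.- (u₃ ℤ.* L₂)} (*-congˡ {v₃} B≈L₁) ⟩
    v₃ ℤ.* L₁ ℤ.- u₃ ℤ.* L₂                            ≡⟨ tidy z L₁ L₂ ⟩
    + 2 ℤ.* (1ℤ ℤ.* X₂)                                ≈⟨ *-congˡ {+ 2} (*-congʳ {X₂} S≈1) ⟨
    + 2 ℤ.* (S ℤ.* X₂)                                 ∎))
    where
    n N : ℕ
    n = k ℕ.+ (k ℕ.+ k)
    N = suc (n ℕ.+ n)
    W : ℤ
    W = wℤ n H.t
    u₃ v₃ : ℤ
    u₃ = ℤ.- (+ 2) ℤ.* (1ℤ ℤ.- + 2 ℤ.* z)
    v₃ = + 2 ℤ.* (1ℤ ℤ.+ + 2 ℤ.* z)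
    2^[n+n]≈G : (+ 2) ^ (n ℕ.+ n) ≈ G
    2^[n+n]≈G = ≈-trans (^-congʳ (+ 2) (count k)) 2^[3h]≈G
      where
      count : ∀ k → (k ℕ.+ (k ℕ.+ k)) ℕ.+ (k ℕ.+ (k ℕ.+ k)) ≡ (k ℕ.+ k) ℕ.+ ((k ℕ.+ k) ℕ.+ (k ℕ.+ k))
      count = ℕ-Solver.solve-∀
    1+N+N≡3p : suc (N ℕ.+ N) ≡ 3 ℕ.* p
    1+N+N≡3p = ≡.trans (count k) (≡.cong (3 ℕ.*_) (≡.sym p≡1+4k))
      where
      count : ∀ k → suc (suc ((k ℕ.+ (k ℕ.+ k)) ℕ.+ (k ℕ.+ (k ℕ.+ k))) ℕ.+ suc ((k ℕ.+ (k ℕ.+ k)) ℕ.+ (k ℕ.+ (k ℕ.+ k))))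
                  ≡ 3 ℕ.* suc ((k ℕ.+ k) ℕ.+ (k ℕ.+ k))
      count = ℕ-Solver.solve-∀
    tidy : ∀ z l₁ l₂ → + 2 ℤ.* (1ℤ ℤ.+ + 2 ℤ.* z) ℤ.* l₁ ℤ.- ℤ.- (+ 2) ℤ.* (1ℤ ℤ.- + 2 ℤ.* z) ℤ.* l₂
                       ≡ + 2 ℤ.* (1ℤ ℤ.* (l₁ ℤ.* (1ℤ ℤ.+ + 2 ℤ.* z) ℤ.+ l₂ ℤ.* (1ℤ ℤ.- + 2 ℤ.* z)))
    tidy = solve-∀

  congruences : (w (p ℕ./ 4) t ≡ rhs₁ [mod p ]) × (w ((3 ℕ.* p) ℕ./ 4) t ≡ rhs₂ [mod p ])
  congruences = ≡.subst (λ n → w n t ≡ rhs₁ [mod p ]) (≡.sym ⌊p/4⌋≡k) (congruence₁ {k} 2w[⌊p/4⌋]≈)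
              , ≡.subst (λ n → w n t ≡ rhs₂ [mod p ]) (≡.sym ⌊3p/4⌋≡3k) (congruence₂ {k ℕ.+ (k ℕ.+ k)} 2w[⌊3p/4⌋]≈)
    where
    ⌊p/4⌋≡k : p ℕ./ 4 ≡ k
    ⌊p/4⌋≡k = ≡.trans (cong (ℕ._/ 4) (≡.trans p≡1+4k (count k))) ([r+m*4]/4≡m 1 k (s≤s (s≤s z≤n)))
      where
      count : ∀ k → suc ((k ℕ.+ k) ℕ.+ (k ℕ.+ k)) ≡ 1 ℕ.+ k ℕ.* 4
      count = ℕ-Solver.solve-∀
    ⌊3p/4⌋≡3k : (3 ℕ.* p) ℕ./ 4 ≡ k ℕ.+ (k ℕ.+ k)
    ⌊3p/4⌋≡3k = ≡.trans (cong (λ q → (3 ℕ.* q) ℕ./ 4) p≡1+4k)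
                  (≡.trans (cong (ℕ._/ 4) (count k)) ([r+m*4]/4≡m 3 (k ℕ.+ (k ℕ.+ k)) (s≤s (s≤s (s≤s (s≤s z≤n))))))
      where
      count : ∀ k → 3 ℕ.* suc ((k ℕ.+ k) ℕ.+ (k ℕ.+ k)) ≡ 3 ℕ.+ (k ℕ.+ (k ℕ.+ k)) ℕ.* 4
      count = ℕ-Solver.solve-∀

-- Here 2⌊p/4⌋ + 1 = (p - 1)/2 and 2⌊3p/4⌋ + 1 = (3p + 1)/2.
module ThreeModFour (p k : ℕ) (p-prime : Prime p) (p≡3+4k : p ≡ suc (suc (k ℕ.+ k) ℕ.+ suc (k ℕ.+ k))) (x : ℚ) (x∈D : InD p x) where
  open import Data.Product using (_×_)
  h : ℕ
  h = suc (k ℕ.+ k)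
  open RationalForm p h p-prime p≡3+4k x x∈D
  open SymbolValues p h p-prime p≡3+4k z
  open PrimeField p p-prime
  private module H = HalfAngleFrobenius p h p-prime p≡3+4k z
  open import Relation.Binary.Reasoning.Setoid ≈-setoid

  S≈-1 : S ≈ ℤ.- 1ℤ
  S≈-1 = *-congˡ {ℤ.- 1ℤ} ([-1]^[k+k]≈1 k)

  B≈-L₁ : H.B ≈ ℤ.- 1ℤ ℤ.* L₁
  B≈-L₁ = ≈-trans [z-1]^h≈SL₁ (*-congʳ {L₁} S≈-1)

  2w[⌊p/4⌋]≈ : + 2 ℤ.* wℤ k H.t ≈ (ℤ.- (+ 2)) ^ h ℤ.* X₁
  2w[⌊p/4⌋]≈ = 2GW≈SX⇒2W≈[-2]^hX (begin
    + 2 ℤ.* G ℤ.* wℤ k H.t                   ≡⟨ ℤP.*-assoc (+ 2) G _ ⟩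
    + 2 ℤ.* (G ℤ.* wℤ k H.t)                 ≈⟨ *-congˡ {+ 2} (H.c₃[e^[N+N]]≈2^N·wₙ k) ⟨
    + 2 ℤ.* H.c₃ (H.e H.^ (h ℕ.+ h))         ≈⟨ H.2c₃[e^[mp-1]] {1} (H.*-identityʳ H.e) 1+h+h≡p ⟩
    1ℤ ℤ.* H.B ℤ.- 1ℤ ℤ.* L₂                 ≈⟨ +-congʳ {ℤ.- (1ℤ ℤ.* L₂)} (*-congˡ {1ℤ} B≈-L₁) ⟩
    1ℤ ℤ.* (ℤ.- 1ℤ ℤ.* L₁) ℤ.- 1ℤ ℤ.* L₂    ≡⟨ tidy L₁ L₂ ⟩
    ℤ.- 1ℤ ℤ.* X₁                            ≈⟨ *-congʳ {X₁} S≈-1 ⟨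
    S ℤ.* X₁                                 ∎)
    where
    1+h+h≡p : suc (h ℕ.+ h) ≡ 1 ℕ.* p
    1+h+h≡p = ≡.trans (≡.sym p≡3+4k) (≡.sym (ℕP.*-identityˡ p))
    tidy : ∀ l₁ l₂ → 1ℤ ℤ.* (ℤ.- 1ℤ ℤ.* l₁) ℤ.- 1ℤ ℤ.* l₂ ≡ ℤ.- 1ℤ ℤ.* (l₁ ℤ.+ l₂)
    tidy = solve-∀

  2w[⌊3p/4⌋]≈ : + 2 ℤ.* wℤ (suc (suc (k ℕ.+ (k ℕ.+ k)))) H.t ≈ (ℤ.- (+ 2)) ^ h ℤ.* X₂
  2w[⌊3p/4⌋]≈ = 2GW≈SX⇒2W≈[-2]^hX (*-cancelˡ 2≉0 (begin
    + 2 ℤ.* (+ 2 ℤ.* G ℤ.* W)                ≡⟨ shuffle G W ⟩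
    + 2 ℤ.* (+ 2 ℤ.* G) ℤ.* W                ≈⟨ *-congʳ {W} (*-congˡ {+ 2} 2^[n+n]≈2G) ⟨
    + 2 ℤ.* (+ 2) ^ (n ℕ.+ n) ℤ.* W          ≈⟨ H.c₃[e^[N+N]]≈2^N·wₙ n ⟨
    H.c₃ (H.e H.^ (N ℕ.+ N))                 ≡⟨ ≡.cong (λ m → H.c₃ (H.e H.^ m)) N+N≡1+3p ⟩
    H.c₃ (H.e H.^ suc (3 ℕ.* p))             ≈⟨ H.c₃[e^[1+mp]] {3} H.e³≈odd ⟩
    u₃ ℤ.* L₂ ℤ.+ v₃ ℤ.* H.B                 ≈⟨ +-congˡ {u₃ ℤ.* L₂} (*-congˡ {v₃} B≈-L₁) ⟩
    u₃ ℤ.* L₂ ℤ.+ v₃ ℤ.* (ℤ.- 1ℤ ℤ.* L₁)    ≡⟨ tidy z L₁ L₂ ⟩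
    + 2 ℤ.* (ℤ.- 1ℤ ℤ.* X₂)                  ≈⟨ *-congˡ {+ 2} (*-congʳ {X₂} S≈-1) ⟨
    + 2 ℤ.* (S ℤ.* X₂)                       ∎))
    where
    n N : ℕ
    n = suc (suc (k ℕ.+ (k ℕ.+ k)))
    N = suc (n ℕ.+ n)
    W : ℤ
    W = wℤ n H.t
    u₃ v₃ : ℤ
    u₃ = ℤ.- (+ 2) ℤ.* (1ℤ ℤ.- + 2 ℤ.* z)
    v₃ = + 2 ℤ.* (1ℤ ℤ.+ + 2 ℤ.* z)
    shuffle : ∀ g w → + 2 ℤ.* (+ 2 ℤ.* g ℤ.* w) ≡ + 2 ℤ.* (+ 2 ℤ.* g) ℤ.* w
    shuffle = solve-∀
    2^[n+n]≈2G : (+ 2) ^ (n ℕ.+ n) ≈ + 2 ℤ.* G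
    2^[n+n]≈2G = ≈-trans (^-congʳ (+ 2) (count k)) (*-congˡ {+ 2} 2^[3h]≈G)
      where
      count : ∀ k → suc (suc (k ℕ.+ (k ℕ.+ k))) ℕ.+ suc (suc (k ℕ.+ (k ℕ.+ k)))
                  ≡ suc (suc (k ℕ.+ k) ℕ.+ (suc (k ℕ.+ k) ℕ.+ suc (k ℕ.+ k)))
      count = ℕ-Solver.solve-∀
    N+N≡1+3p : N ℕ.+ N ≡ suc (3 ℕ.* p)
    N+N≡1+3p = ≡.trans (count k) (≡.cong (λ q → suc (3 ℕ.* q)) (≡.sym p≡3+4k))
      where
      count : ∀ k → suc (suc (suc (k ℕ.+ (k ℕ.+ k))) ℕ.+ suc (suc (k ℕ.+ (k ℕ.+ k))))
                    ℕ.+ suc (suc (suc (k ℕ.+ (k ℕ.+ k))) ℕ.+ suc (suc (k ℕ.+ (k ℕ.+ k))))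
                  ≡ suc (3 ℕ.* suc (suc (k ℕ.+ k) ℕ.+ suc (k ℕ.+ k)))
      count = ℕ-Solver.solve-∀
    tidy : ∀ z l₁ l₂ → ℤ.- (+ 2) ℤ.* (1ℤ ℤ.- + 2 ℤ.* z) ℤ.* l₂ ℤ.+ + 2 ℤ.* (1ℤ ℤ.+ + 2 ℤ.* z) ℤ.* (ℤ.- 1ℤ ℤ.* l₁)
                       ≡ + 2 ℤ.* (ℤ.- 1ℤ ℤ.* (l₁ ℤ.* (1ℤ ℤ.+ + 2 ℤ.* z) ℤ.+ l₂ ℤ.* (1ℤ ℤ.- + 2 ℤ.* z)))
    tidy = solve-∀

  congruences : (w (p ℕ./ 4) t ≡ rhs₁ [mod p ]) × (w ((3 ℕ.* p) ℕ./ 4) t ≡ rhs₂ [mod p ])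
  congruences = ≡.subst (λ n → w n t ≡ rhs₁ [mod p ]) (≡.sym ⌊p/4⌋≡k) (congruence₁ {k} 2w[⌊p/4⌋]≈)
              , ≡.subst (λ n → w n t ≡ rhs₂ [mod p ]) (≡.sym ⌊3p/4⌋≡3k+2) (congruence₂ {suc (suc (k ℕ.+ (k ℕ.+ k)))} 2w[⌊3p/4⌋]≈)
    where
    ⌊p/4⌋≡k : p ℕ./ 4 ≡ k
    ⌊p/4⌋≡k = ≡.trans (cong (ℕ._/ 4) (≡.trans p≡3+4k (count k))) ([r+m*4]/4≡m 3 k (s≤s (s≤s (s≤s (s≤s z≤n)))))
      where
      count : ∀ k → suc (suc (k ℕ.+ k) ℕ.+ suc (k ℕ.+ k)) ≡ 3 ℕ.+ k ℕ.* 4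
      count = ℕ-Solver.solve-∀
    ⌊3p/4⌋≡3k+2 : (3 ℕ.* p) ℕ./ 4 ≡ suc (suc (k ℕ.+ (k ℕ.+ k)))
    ⌊3p/4⌋≡3k+2 = ≡.trans (cong (λ q → (3 ℕ.* q) ℕ./ 4) p≡3+4k)
                    (≡.trans (cong (ℕ._/ 4) (count k)) ([r+m*4]/4≡m 1 _ (s≤s (s≤s z≤n))))
      where
      count : ∀ k → 3 ℕ.* suc (suc (k ℕ.+ k) ℕ.+ suc (k ℕ.+ k)) ≡ 1 ℕ.+ suc (suc (k ℕ.+ (k ℕ.+ k))) ℕ.* 4
      count = ℕ-Solver.solve-∀

odd-prime-mod-4 : ∀ {p} → Prime p → 2 < p →
  (Σ ℕ λ k → p ≡ suc ((k ℕ.+ k) ℕ.+ (k ℕ.+ k))) ⊎ (Σ ℕ λ k → p ≡ suc (suc (k ℕ.+ k) ℕ.+ suc (k ℕ.+ k)))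
odd-prime-mod-4 {p} p-prime 2<p = by-residue (p ℕ.% 4) (ℕ÷.m%n<n p 4) (ℕ÷.m≡m%n+[m/n]*n p 4)
  where
  k : ℕ
  k = p ℕ./ 4
  odd : ¬ 2 ℕ∣.∣ p
  odd 2∣p = [ (λ ()) , (λ 2≡p → ℕP.<-irrefl 2≡p 2<p) ]′ (prime⇒irreducible p-prime 2∣p)
  by-residue : ∀ r → r < 4 → p ≡ r ℕ.+ k ℕ.* 4 →
    (Σ ℕ λ k → p ≡ suc ((k ℕ.+ k) ℕ.+ (k ℕ.+ k))) ⊎ (Σ ℕ λ k → p ≡ suc (suc (k ℕ.+ k) ℕ.+ suc (k ℕ.+ k)))
  by-residue 0 _ p≡4k = ⊥-elim (odd (ℕ∣.divides (k ℕ.* 2) (≡.trans p≡4k (four k))))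
    where
    four : ∀ k → 0 ℕ.+ k ℕ.* 4 ≡ k ℕ.* 2 ℕ.* 2
    four = ℕ-Solver.solve-∀
  by-residue 1 _ p≡1+4k = inj₁ (k , ≡.trans p≡1+4k (four k))
    where
    four : ∀ k → 1 ℕ.+ k ℕ.* 4 ≡ suc ((k ℕ.+ k) ℕ.+ (k ℕ.+ k))
    four = ℕ-Solver.solve-∀
  by-residue 2 _ p≡2+4k = ⊥-elim (odd (ℕ∣.divides (suc (k ℕ.* 2)) (≡.trans p≡2+4k (four k))))
    where
    four : ∀ k → 2 ℕ.+ k ℕ.* 4 ≡ suc (k ℕ.* 2) ℕ.* 2
    four = ℕ-Solver.solve-∀
  by-residue 3 _ p≡3+4k = inj₂ (k , ≡.trans p≡3+4k (four k))
    where
    four : ∀ k → 3 ℕ.+ k ℕ.* 4 ≡ suc (suc (k ℕ.+ k) ℕ.+ suc (k ℕ.+ k))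
    four = ℕ-Solver.solve-∀
  by-residue (suc (suc (suc (suc _)))) (s≤s (s≤s (s≤s (s≤s ())))) _

open import Data.Nat using (_/_; _*_)
open import Data.Product using (_×_)

lemma8 : (p : ℕ) → Prime p → 3 < p → (x : ℚ) → InD p x →
    let t = (+ 2 ℚ./ 1) ℚ.* x ℚ.* x ℚ.- 1ℚ
        two = + 2 ℚ./ 1
    in (w (p / 4) t ≡ ½ ℚ.* legendre (ℚ.- (+ 2 ℚ./ 1)) p ℚ.* (legendre (1ℚ ℚ.- x) p ℚ.+ legendre (1ℚ ℚ.+ x) p) [mod p ])
     × (w ((3 * p) / 4) t ≡ ½ ℚ.* legendre (ℚ.- (+ 2 ℚ./ 1)) p ℚ.* (legendre (1ℚ ℚ.- x) p ℚ.* (1ℚ ℚ.+ two ℚ.* x) ℚ.+ legendre (1ℚ ℚ.+ x) p ℚ.* (1ℚ ℚ.- two ℚ.* x)) [mod p ])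
lemma8 p p-prime 3<p x x∈D with odd-prime-mod-4 p-prime (ℕP.<-trans (ℕP.n<1+n 2) 3<p)
... | inj₁ (k , p≡1+4k) = OneModFour.congruences p k p-prime p≡1+4k x x∈D
... | inj₂ (k , p≡3+4k) = ThreeModFour.congruences p k p-prime p≡3+4k x x∈D
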